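{- Let $q$ be an indeterminate, $[n]=1+q+\dots+q^{n-1}$, $[n]!=[1]\cdots[n]$, and let $e_n(q)$ be defined by the power product expansion $\sum_{n\ge0}\frac{x^n}{[n]!}=\prod_{n\ge1}(1+e_n(q)x^n)$. Put $c_n(q)=[n]!\,e_n(q)$, and let $c_n$ be the integers with $\exp(x)=\sum_{n\ge0}\frac{x^n}{n!}=\prod_{n\ge1}\bigl(1+\frac{c_n}{n!}x^n\bigr)$. Let $n\ge m$ be positive integers and $\zeta_m=e^{2\pi i/m}$. If $n=mk$ then $c_{mk}(\zeta_m)=c_k$; if $n$ is not a multiple of $m$ then $c_n(\zeta_m)=0$.
   Context: A power product expansion of a formal power series $f(x)=\sum_{n\ge0}a_nx^n$ with $a_0=1$ is the unique representation $f(x)=\prod_{n\ge1}(1+g_nx^n)$. It is known (and shown in the paper) that each $c_n(q)=[n]!\,e_n(q)$ is a polynomial in $q$ with integer coefficients, so evaluation at $\zeta_m$ makes sense; $c_n=n!\,e_n$ with $e_n$ the power product coefficients of $\exp(x)$ are integers ($c_1,c_2,\dots=1,1,-2,9,-24,130,\dots$). -}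

module Defs where

open import Data.Nat as ℕ using (ℕ; zero; suc; _≤?_; _≡ᵇ_; _!)
open import Data.Nat.Properties using (_!≢0)
open import Data.Nat.Divisibility using (_∣?_)
open import Data.Integer as ℤ using (ℤ; +_)
open import Data.Rational as ℚ using (ℚ)
open import Data.List using (List; []; _∷_; replicate; foldr)
open import Data.Product using (Σ; _×_; _,_; proj₁; proj₂)
open import Data.Bool using (if_then_else_)
open import Relation.Nullary using (does)
open import Relation.Binary.PropositionalEquality using (_≡_)

-- For a sequence a (with a₀ = 1) the unique
-- g with  Σ aₙ xⁿ = ∏_{n≥1} (1 + gₙ xⁿ)  is computed by the recursion
--   gₙ = aₙ - [xⁿ] ∏_{k=1}^{n-1} (1 + g_k x^k).

module PowerProduct {A : Set} (0# 1# : A) (_+_ _*_ : A → A → A) (-_ : A → A) where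

  -- prodCoeff g j n = [xⁿ] ∏_{k=1}^{j} (1 + g k x^k)
  prodCoeff : (ℕ → A) → ℕ → ℕ → A
  prodCoeff g zero zero = 1#
  prodCoeff g zero (suc n) = 0#
  prodCoeff g (suc j) n =
    prodCoeff g j n +
    (if does (suc j ≤? n) then g (suc j) * prodCoeff g j (n ℕ.∸ suc j) else 0#)

  -- table a n k = g_k for 1 ≤ k ≤ n (and 0# outside)
  table : (ℕ → A) → ℕ → ℕ → A
  table a zero k = 0#
  table a (suc n) k =
    if k ≡ᵇ suc n
    then a (suc n) + (- prodCoeff (table a n) n (suc n))
    else table a n k

  ppCoeff : (ℕ → A) → ℕ → A
  ppCoeff a n = table a n n

-- Polynomials in ℤ[q] as coefficient lists (constant term first).

Poly : Set
Poly = List ℤ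

coeff : Poly → ℕ → ℤ
coeff [] i = + 0
coeff (a ∷ p) zero = a
coeff (a ∷ p) (suc i) = coeff p i

-- equality of polynomials (coefficientwise; trailing zeros irrelevant)
_≈P_ : Poly → Poly → Set
p ≈P r = ∀ i → coeff p i ≡ coeff r i

infix 4 _≈P_
infixl 6 _+P_ _-P_
infixl 7 _*P_

_+P_ : Poly → Poly → Poly
[] +P r = r
(a ∷ p) +P [] = a ∷ p
(a ∷ p) +P (b ∷ r) = (a ℤ.+ b) ∷ (p +P r)

negP : Poly → Poly
negP [] = []
negP (a ∷ p) = ℤ.- a ∷ negP p

_-P_ : Poly → Poly → Poly
p -P r = p +P negP r

scaleP : ℤ → Poly → Poly
scaleP c [] = []
scaleP c (a ∷ p) = (c ℤ.* a) ∷ scaleP c p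

_*P_ : Poly → Poly → Poly
[] *P r = []
(a ∷ p) *P r = scaleP a r +P (+ 0 ∷ (p *P r))

constP : ℤ → Poly
constP c = c ∷ []

zeroP oneP : Poly
zeroP = []
oneP = constP (+ 1)

monoP : ℕ → Poly
monoP n = replicate n (+ 0) Data.List.++ (+ 1 ∷ [])
  where import Data.List

_∣P_ : Poly → Poly → Set
d ∣P p = Σ Poly λ s → d *P s ≈P p

qint : ℕ → Poly
qint n = replicate n (+ 1)

qfact : ℕ → Poly
qfact zero = oneP
qfact (suc n) = qfact n *P qint (suc n)

-- The fraction ring of ℤ[q] (elements of ℚ(q) as numerator/denominator).
-- Only ring operations are needed by the recursion; all denominators
-- occurring are products of q-factorials, hence nonzero.

Frac : Set
Frac = Poly × Poly

_+F_ _*F_ : Frac → Frac → Frac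
(a , b) +F (c , d) = (a *P d +P c *P b) , (b *P d)
(a , b) *F (c , d) = (a *P c) , (b *P d)

negF : Frac → Frac
negF (a , b) = negP a , b

open PowerProduct ([] , oneP) (oneP , oneP) _+F_ _*F_ negF
  renaming (ppCoeff to ppCoeffF) using ()

eq : ℕ → Frac
eq = ppCoeffF (λ n → oneP , qfact n)

-- "P is the polynomial c_n(q) = [n]! e_n(q)" (equality in ℚ(q))
IsCq : ℕ → Poly → Set
IsCq n P = P *P proj₂ (eq n) ≈P qfact n *P proj₁ (eq n)

open PowerProduct (ℚ.0ℚ) (ℚ.1ℚ) ℚ._+_ ℚ._*_ ℚ.-_
  renaming (ppCoeff to ppCoeffQ) using ()

eExp : ℕ → ℚ
eExp = ppCoeffQ (λ n → (+ 1 ℚ./ (n !)) {{n !≢0}})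

cExp : ℕ → ℚ
cExp n = (+ (n !) ℚ./ 1) ℚ.* eExp n

-- Cyclotomic polynomials, characterised by  ∏_{d ∣ m} Φ_d = q^m - 1
-- for all m ≥ 1 (this determines the Φ_m uniquely in ℤ[q]).

divProd : (ℕ → Poly) → ℕ → ℕ → Poly
divProd Φ m zero = oneP
divProd Φ m (suc j) =
  if does (suc j ∣? m) then divProd Φ m j *P Φ (suc j) else divProd Φ m j

IsCyclotomic : (ℕ → Poly) → Set
IsCyclotomic Φ = ∀ m → 1 ℕ.≤ m → divProd Φ m m ≈P monoP m -P oneP

-- P(ζ_m) = c for an integer c, where ζ_m = e^{2πi/m}: since Φ_m is the
-- minimal polynomial of ζ_m over ℚ, this holds iff Φ_m ∣ P - c in ℤ[q]
-- (evaluation in ℤ[ζ_m] ≅ ℤ[q]/(Φ_m)).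
EvalAtZeta : (ℕ → Poly) → ℕ → Poly → ℤ → Set
EvalAtZeta Φ m P c = Φ m ∣P (P -P constP c)

{-# OPTIONS --safe #-}
-- c n(q) = [n]! e n(q) is the unique g with P_n(n) = 1 for all n, where
-- P_j(n) = [n]! [xⁿ] ∏_{k ≤ j} (1 + g k xᵏ/[k]!) obeys a recursion in the
-- Gaussian binomials; the integers c n satisfy the same with ordinary ones.
-- Modulo Φ m, i.e. at q = ζ m, the Gaussian binomials satisfy the q-Lucas
-- congruence [r + a m choose s + i m]_q ≡ [r choose s]_q (a choose i) for
-- r, s < m, because Φ m divides [m choose k]_q for 0 < k < m.  Consequently
-- the partial products factor into a part below m and the partial products
-- of exp on the multiples of m, so the sequence that is c k(q) for k < m,
-- c (k/m) on multiples of m and 0 elsewhere satisfies the recursion modulo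
-- Φ m; by uniqueness it agrees with c k(q) modulo Φ m.
module Submission where

open import Defs
open import Level using (0ℓ)
open import Algebra.Bundles using (CommutativeMonoid; CommutativeRing)
import Algebra.Properties.CommutativeSemigroup as CommSemigroupProperties
open import Data.Bool using (if_then_else_)
open import Data.Empty using (⊥-elim)
open import Data.Integer as ℤ using (ℤ; +_)
open import Data.Integer.Divisibility.Signed as ℤ∣ using () renaming (_∣_ to _ℤ∣_)
import Data.Integer.Properties as ℤP
import Data.Integer.Tactic.RingSolver as ℤSolver
open import Data.List using ([]; _∷_)
open import Data.Maybe using (Maybe; just; nothing; map)
open import Data.Nat as ℕ using (ℕ; zero; suc; _!; _∸_; _≤_; _<_; z≤n; s≤s; _≤?_; _≡ᵇ_)
open import Data.Nat.Combinatorics using (_C_; nCk≡n!/k![n-k]!; k![n∸k]!∣n!; nCk+nC[k+1]≡[n+1]C[k+1]; nCn≡1)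
open import Data.Nat.Divisibility as ℕ∣ using (_∣_; _∣?_; ∣-refl; ∣-trans; ∣⇒≤)
open import Data.Nat.DivMod using (m/n*n≡m; m*n/n≡m; m≡m%n+[m/n]*n; m%n<n)
open import Data.Nat.GCD using (GCD; module Bézout)
open import Data.Nat.Induction using (<-rec)
import Data.Nat.Properties as ℕP
open import Data.Nat.Properties using (_!≢0; _!*_!≢0)
open import Data.Product using (Σ; _,_; _×_; proj₁; proj₂)
open import Data.Rational as ℚ using (ℚ; _/_)
import Data.Rational.Properties as ℚP
import Data.Rational.Unnormalised as ℚᵘ
import Data.Rational.Unnormalised.Properties as ℚᵘP
open import Function using (_$_)
open import Relation.Binary.Core using (Rel)
open import Relation.Binary.PropositionalEquality as ≡ using (_≡_; refl; cong; cong₂)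
import Relation.Binary.Reasoning.Setoid as SetoidReasoning
open import Relation.Nullary using (Dec; does; yes; no; ¬_)
open import Relation.Nullary.Decidable using (dec-true; dec-false)
open import Tactic.RingSolver using (solve-∀)
import Tactic.RingSolver.Core.AlmostCommutativeRing as ACR

if-yes : ∀ {P : Set} (d : Dec P) {A : Set} {x y : A} → P → (if does d then x else y) ≡ x
if-yes d p = cong (if_then _ else _) (dec-true d p)

if-no : ∀ {P : Set} (d : Dec P) {A : Set} {x y : A} → ¬ P → (if does d then x else y) ≡ y
if-no d ¬p = cong (if_then _ else _) (dec-false d ¬p)

-- If binom n k = F n / (F k * F (n ∸ k)) for some F, then
--   scaledProd g j n = F n * [xⁿ] ∏_{k=1}^{j} (1 + g k xᵏ / F k),
-- and scaledCoeff k = F k * e k for the power product coefficients e of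
-- Σ xⁿ / F n, computed by the same table as in Defs.PowerProduct.
module ScaledPowerProduct {A : Set} (0# 1# : A) (_+_ _*_ : A → A → A) (-_ : A → A)
                          (binom : ℕ → ℕ → A) where

  scaledProd : (ℕ → A) → ℕ → ℕ → A
  scaledProd g zero    zero    = 1#
  scaledProd g zero    (suc n) = 0#
  scaledProd g (suc j) n       =
    scaledProd g j n +
    (if does (suc j ≤? n) then (binom n (suc j) * g (suc j)) * scaledProd g j (n ∸ suc j) else 0#)

  scaledTable : ℕ → ℕ → A
  scaledTable zero    k = 0#
  scaledTable (suc n) k =
    if k ≡ᵇ suc n then 1# + (- scaledProd (scaledTable n) n (suc n)) else scaledTable n k

  scaledCoeff : ℕ → A
  scaledCoeff n = scaledTable n n

module ScaledPowerProductLaws (R : CommutativeRing 0ℓ 0ℓ) (binom : ℕ → ℕ → CommutativeRing.Carrier R) where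
  open CommutativeRing R renaming (refl to ≈-refl) hiding (zero)
  open ScaledPowerProduct 0# 1# _+_ _*_ -_ binom public
  open SetoidReasoning setoid
  open import Algebra.Properties.Group +-group using (\\-leftDividesˡ; \\-leftDividesʳ)

  scaledProd-≤ : ∀ g j n → suc j ≤ n →
    scaledProd g (suc j) n ≈ scaledProd g j n + (binom n (suc j) * g (suc j)) * scaledProd g j (n ∸ suc j)
  scaledProd-≤ g j n p = reflexive (cong (λ z → scaledProd g j n + z) (if-yes (suc j ≤? n) p))

  scaledProd-≰ : ∀ g j n → ¬ suc j ≤ n → scaledProd g (suc j) n ≈ scaledProd g j n
  scaledProd-≰ g j n ¬p =
    trans (reflexive (cong (λ z → scaledProd g j n + z) (if-no (suc j ≤? n) ¬p))) (+-identityʳ _)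

  scaledProd-cong : ∀ {g g'} j → (∀ k → 1 ≤ k → k ≤ j → g k ≈ g' k) →
                    ∀ n → scaledProd g j n ≈ scaledProd g' j n
  scaledProd-cong zero    _ zero    = ≈-refl
  scaledProd-cong zero    _ (suc n) = ≈-refl
  scaledProd-cong {g} {g'} (suc j) g≈g' n with suc j ≤? n
  ... | yes p = begin
    scaledProd g (suc j) n
      ≈⟨ scaledProd-≤ g j n p ⟩
    scaledProd g j n + (binom n (suc j) * g (suc j)) * scaledProd g j (n ∸ suc j)
      ≈⟨ +-cong (IH n) (*-cong (*-congˡ (g≈g' (suc j) (s≤s z≤n) ℕP.≤-refl)) (IH (n ∸ suc j))) ⟩
    scaledProd g' j n + (binom n (suc j) * g' (suc j)) * scaledProd g' j (n ∸ suc j)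
      ≈⟨ scaledProd-≤ g' j n p ⟨
    scaledProd g' (suc j) n ∎
    where IH = scaledProd-cong j (λ k 1≤k k≤j → g≈g' k 1≤k (ℕP.m≤n⇒m≤1+n k≤j))
  ... | no ¬p = trans (scaledProd-≰ g j n ¬p)
                  (trans (scaledProd-cong j (λ k 1≤k k≤j → g≈g' k 1≤k (ℕP.m≤n⇒m≤1+n k≤j)) n)
                    (sym (scaledProd-≰ g' j n ¬p)))

  scaledProd-0 : ∀ g j → scaledProd g j 0 ≈ 1#
  scaledProd-0 g zero    = ≈-refl
  scaledProd-0 g (suc j) = trans (scaledProd-≰ g j 0 λ ()) (scaledProd-0 g j)

  scaledProd-skip : ∀ g j n → g (suc j) ≈ 0# → scaledProd g (suc j) n ≈ scaledProd g j n
  scaledProd-skip g j n g≈0 with suc j ≤? n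
  ... | no ¬p = scaledProd-≰ g j n ¬p
  ... | yes p = begin
    scaledProd g (suc j) n                                                  ≈⟨ scaledProd-≤ g j n p ⟩
    scaledProd g j n + (binom n (suc j) * g (suc j)) * scaledProd g j (n ∸ suc j)
                                                                            ≈⟨ +-congˡ (*-congʳ (*-congˡ g≈0)) ⟩
    scaledProd g j n + (binom n (suc j) * 0#) * scaledProd g j (n ∸ suc j) ≈⟨ +-congˡ (*-congʳ (zeroʳ _)) ⟩
    scaledProd g j n + 0# * scaledProd g j (n ∸ suc j)                      ≈⟨ +-congˡ (zeroˡ _) ⟩
    scaledProd g j n + 0#                                                   ≈⟨ +-identityʳ _ ⟩
    scaledProd g j n                                                        ∎

  scaledProd-stable : ∀ g d n → scaledProd g (d ℕ.+ n) n ≈ scaledProd g n n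
  scaledProd-stable g zero    n = ≈-refl
  scaledProd-stable g (suc d) n =
    trans (scaledProd-≰ g (d ℕ.+ n) n λ p → ℕP.<⇒≱ p (ℕP.m≤n+m n d)) (scaledProd-stable g d n)

  scaledTable-stable : ∀ n k → 1 ≤ k → k ≤ n → scaledTable n k ≡ scaledCoeff k
  scaledTable-stable zero    (suc k) _ ()
  scaledTable-stable (suc n) k 1≤k k≤n with k ℕ.≟ suc n
  ... | yes refl = refl
  ... | no k≢n   = ≡.trans (if-no (k ℕ.≟ suc n) k≢n)
                     (scaledTable-stable n k 1≤k (ℕP.≤-pred (ℕP.≤∧≢⇒< k≤n k≢n)))

  scaledCoeff-rec : ∀ n → scaledCoeff (suc n) ≈ 1# + - scaledProd scaledCoeff n (suc n)
  scaledCoeff-rec n = begin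
    scaledCoeff (suc n)                            ≡⟨ if-yes (suc n ℕ.≟ suc n) refl ⟩
    1# + - scaledProd (scaledTable n) n (suc n)    ≈⟨ +-congˡ (-‿cong (scaledProd-cong n stable (suc n))) ⟩
    1# + - scaledProd scaledCoeff n (suc n)        ∎
    where stable = λ k 1≤k k≤n → reflexive (scaledTable-stable n k 1≤k k≤n)

  module _ (binom-diag : ∀ n → binom n n ≈ 1#) where

    scaledProd-last : ∀ g n → scaledProd g (suc n) (suc n) ≈ scaledProd g n (suc n) + g (suc n)
    scaledProd-last g n = begin
      scaledProd g (suc n) (suc n)
        ≈⟨ scaledProd-≤ g n (suc n) ℕP.≤-refl ⟩
      scaledProd g n (suc n) + (binom (suc n) (suc n) * g (suc n)) * scaledProd g n (suc n ∸ suc n)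
        ≈⟨ +-congˡ (*-cong (trans (*-congʳ (binom-diag (suc n))) (*-identityˡ _))
                           (reflexive (cong (scaledProd g n) (ℕP.n∸n≡0 n)))) ⟩
      scaledProd g n (suc n) + g (suc n) * scaledProd g n 0
        ≈⟨ +-congˡ (trans (*-congˡ (scaledProd-0 g n)) (*-identityʳ _)) ⟩
      scaledProd g n (suc n) + g (suc n) ∎

    scaledProd-diag : ∀ n → scaledProd scaledCoeff n n ≈ 1#
    scaledProd-diag zero    = ≈-refl
    scaledProd-diag (suc n) = begin
      scaledProd scaledCoeff (suc n) (suc n)  ≈⟨ scaledProd-last scaledCoeff n ⟩
      P + scaledCoeff (suc n)                 ≈⟨ +-congˡ (trans (scaledCoeff-rec n) (+-comm 1# (- P))) ⟩
      P + (- P + 1#)                          ≈⟨ \\-leftDividesˡ P 1# ⟩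
      1#                                      ∎
      where P = scaledProd scaledCoeff n (suc n)

    scaledProd-above : ∀ {j n} → n ≤ j → scaledProd scaledCoeff j n ≈ 1#
    scaledProd-above {j} {n} n≤j = begin
      scaledProd scaledCoeff j n               ≡⟨ cong (λ t → scaledProd scaledCoeff t n) (ℕP.m∸n+n≡m n≤j) ⟨
      scaledProd scaledCoeff (j ∸ n ℕ.+ n) n   ≈⟨ scaledProd-stable scaledCoeff (j ∸ n) n ⟩
      scaledProd scaledCoeff n n               ≈⟨ scaledProd-diag n ⟩
      1#                                       ∎

    scaledCoeff-unique : ∀ g → (∀ n → scaledProd g n n ≈ 1#) → ∀ k → 1 ≤ k → g k ≈ scaledCoeff k
    scaledCoeff-unique g diag k 1≤k = agree k k 1≤k ℕP.≤-refl
      where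
      agree : ∀ n k → 1 ≤ k → k ≤ n → g k ≈ scaledCoeff k
      agree zero    (suc k) _ ()
      agree (suc n) k 1≤k k≤n with k ℕ.≟ suc n
      ... | no k≢n  = agree n k 1≤k (ℕP.≤-pred (ℕP.≤∧≢⇒< k≤n k≢n))
      ... | yes refl = begin
        g (suc n)                               ≈⟨ \\-leftDividesʳ P (g (suc n)) ⟨
        - P + (P + g (suc n))                   ≈⟨ +-congˡ (trans (sym (scaledProd-last g n)) (diag (suc n))) ⟩
        - P + 1#                                ≈⟨ +-comm (- P) 1# ⟩
        1# + - P                                ≈⟨ +-congˡ (-‿cong (scaledProd-cong n (agree n) (suc n))) ⟩
        1# + - scaledProd scaledCoeff n (suc n) ≈⟨ scaledCoeff-rec n ⟨
        scaledCoeff (suc n)                     ∎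
        where P = scaledProd g n (suc n)

-- Ratio x r s says that x = r / s.  If the coefficients aₙ of a series in A
-- are 1 / fact n, its power product coefficients are scaledCoeff k / fact k.
module PowerProductAsRatio
  {A : Set} (0# 1# : A) (_+_ _*_ : A → A → A) (-_ : A → A)
  (R : CommutativeRing 0ℓ 0ℓ) (binom : ℕ → ℕ → CommutativeRing.Carrier R)
  (fact : ℕ → CommutativeRing.Carrier R)
  where

  module R = CommutativeRing R
  open ScaledPowerProductLaws R binom
  open PowerProduct 0# 1# _+_ _*_ -_

  module _
    (Ratio : A → R.Carrier → R.Carrier → Set)
    (ratio-cong : ∀ {x r r' s s'} → r R.≈ r' → s R.≈ s' → Ratio x r s → Ratio x r' s')
    (ratio-+ : ∀ {x y r t s} → Ratio x r s → Ratio y t s → Ratio (x + y) (r R.+ t) s)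
    (ratio-* : ∀ {x y r t s u} → Ratio x r s → Ratio y t u → Ratio (x * y) (r R.* t) (s R.* u))
    (ratio-neg : ∀ {x r s} → Ratio x r s → Ratio (- x) (R.- r) s)
    (ratio-expand : ∀ {x r s} c → Ratio x r s → Ratio x (c R.* r) (c R.* s))
    (ratio-0 : ∀ s → Ratio 0# R.0# s)
    (ratio-1 : Ratio 1# R.1# (fact 0))
    (fact-binom : ∀ n k → k ≤ n → fact n R.≈ binom n k R.* (fact k R.* fact (n ∸ k)))
    (a : ℕ → A) (ratio-a : ∀ n → Ratio (a n) R.1# (fact n))
    where

    prodCoeff-ratio : ∀ g j → (∀ k → 1 ≤ k → k ≤ j → Ratio (g k) (scaledCoeff k) (fact k)) →
                      ∀ n → Ratio (prodCoeff g j n) (scaledProd scaledCoeff j n) (fact n)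
    prodCoeff-ratio g zero    _ zero    = ratio-1
    prodCoeff-ratio g zero    _ (suc n) = ratio-0 (fact (suc n))
    prodCoeff-ratio g (suc j) ratio-g n with suc j ≤? n
    ... | yes p = ≡.subst (λ x → Ratio x _ (fact n)) (≡.sym (cong (λ z → prodCoeff g j n + z) (if-yes (suc j ≤? n) p)))
                    (ratio-cong (R.sym (scaledProd-≤ scaledCoeff j n p)) R.refl
                      (ratio-+ (IH n)
                        (ratio-cong (R.sym (R.*-assoc _ _ _)) (R.sym (fact-binom n (suc j) p))
                          (ratio-expand (binom n (suc j)) (ratio-* (ratio-g (suc j) (s≤s z≤n) ℕP.≤-refl) (IH (n ∸ suc j)))))))
      where IH = prodCoeff-ratio g j (λ k 1≤k k≤j → ratio-g k 1≤k (ℕP.m≤n⇒m≤1+n k≤j))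
    ... | no ¬p = ≡.subst (λ x → Ratio x _ (fact n)) (≡.sym (cong (λ z → prodCoeff g j n + z) (if-no (suc j ≤? n) ¬p)))
                    (ratio-cong (R.trans (R.+-identityʳ _) (R.sym (scaledProd-≰ scaledCoeff j n ¬p))) R.refl
                      (ratio-+ (prodCoeff-ratio g j (λ k 1≤k k≤j → ratio-g k 1≤k (ℕP.m≤n⇒m≤1+n k≤j)) n)
                        (ratio-0 (fact n))))

    table-ratio : ∀ n k → 1 ≤ k → k ≤ n → Ratio (table a n k) (scaledCoeff k) (fact k)
    table-ratio zero    (suc k) _ ()
    table-ratio (suc n) k 1≤k k≤n with k ℕ.≟ suc n
    ... | yes refl = ≡.subst (λ x → Ratio x _ (fact (suc n))) (≡.sym (if-yes (suc n ℕ.≟ suc n) refl))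
                       (ratio-cong (R.sym (scaledCoeff-rec n)) R.refl
                         (ratio-+ (ratio-a (suc n))
                           (ratio-neg (prodCoeff-ratio (table a n) n (table-ratio n) (suc n)))))
    ... | no k≢n   = ≡.subst (λ x → Ratio x _ (fact k)) (≡.sym (if-no (k ℕ.≟ suc n) k≢n))
                       (table-ratio n k 1≤k (ℕP.≤-pred (ℕP.≤∧≢⇒< k≤n k≢n)))

    ppCoeff-ratio : ∀ k → 1 ≤ k → Ratio (ppCoeff a k) (scaledCoeff k) (fact k)
    ppCoeff-ratio k 1≤k = table-ratio k k 1≤k ℕP.≤-refl

-- Opened only now: the ring-generic modules above use _+_ and _*_ for the ring.
open import Data.Nat using (_+_; _*_)

-- _≈P_ is a function type, from which Agda cannot infer the two
-- polynomials; wrapped in a record they become inferable.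
infix 4 _≋_
record _≋_ (p r : Poly) : Set where
  constructor mk≋
  field coeff-≡ : p ≈P r
open _≋_ public

≋-refl : ∀ {p} → p ≋ p
≋-refl = mk≋ λ _ → refl

≋-reflexive : ∀ {p r} → p ≡ r → p ≋ r
≋-reflexive refl = ≋-refl

≋-sym : ∀ {p r} → p ≋ r → r ≋ p
≋-sym (mk≋ e) = mk≋ λ i → ≡.sym (e i)

≋-trans : ∀ {p r s} → p ≋ r → r ≋ s → p ≋ s
≋-trans (mk≋ e) (mk≋ f) = mk≋ λ i → ≡.trans (e i) (f i)

∷-cong : ∀ {a a' p p'} → a ≡ a' → p ≋ p' → a ∷ p ≋ a' ∷ p'
∷-cong e f = mk≋ λ { zero → e ; (suc i) → coeff-≡ f i }

∷-injectiveʳ : ∀ {a a' p p'} → a ∷ p ≋ a' ∷ p' → p ≋ p'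
∷-injectiveʳ (mk≋ e) = mk≋ λ i → e (suc i)

[0]≋[] : + 0 ∷ [] ≋ []
[0]≋[] = mk≋ λ { zero → refl ; (suc i) → refl }

coeff-+P : ∀ p r i → coeff (p +P r) i ≡ coeff p i ℤ.+ coeff r i
coeff-+P []      r       i       = ≡.sym (ℤP.+-identityˡ _)
coeff-+P (a ∷ p) []      i       = ≡.sym (ℤP.+-identityʳ _)
coeff-+P (a ∷ p) (b ∷ r) zero    = refl
coeff-+P (a ∷ p) (b ∷ r) (suc i) = coeff-+P p r i

coeff-negP : ∀ p i → coeff (negP p) i ≡ ℤ.- coeff p i
coeff-negP []      i       = refl
coeff-negP (a ∷ p) zero    = refl
coeff-negP (a ∷ p) (suc i) = coeff-negP p i

coeff-scaleP : ∀ c p i → coeff (scaleP c p) i ≡ c ℤ.* coeff p i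
coeff-scaleP c []      i       = ≡.sym (ℤP.*-zeroʳ c)
coeff-scaleP c (a ∷ p) zero    = refl
coeff-scaleP c (a ∷ p) (suc i) = coeff-scaleP c p i

coeff-∷*P : ∀ a p r i →
            coeff ((a ∷ p) *P r) i ≡ a ℤ.* coeff r i ℤ.+ coeff (+ 0 ∷ p *P r) i
coeff-∷*P a p r i =
  ≡.trans (coeff-+P (scaleP a r) _ i) (cong (ℤ._+ _) (coeff-scaleP a r i))

+P-cong : ∀ {p p' r r'} → p ≋ p' → r ≋ r' → p +P r ≋ p' +P r'
+P-cong {p} {p'} {r} {r'} (mk≋ e) (mk≋ f) = mk≋ λ i →
  ≡.trans (coeff-+P p r i) (≡.trans (cong₂ ℤ._+_ (e i) (f i)) (≡.sym (coeff-+P p' r' i)))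

+P-congˡ : ∀ {p p'} r → p ≋ p' → p +P r ≋ p' +P r
+P-congˡ r e = +P-cong e (≋-refl {r})

+P-congʳ : ∀ p {r r'} → r ≋ r' → p +P r ≋ p +P r'
+P-congʳ p = +P-cong (≋-refl {p})

negP-cong : ∀ {p p'} → p ≋ p' → negP p ≋ negP p'
negP-cong {p} {p'} (mk≋ e) = mk≋ λ i →
  ≡.trans (coeff-negP p i) (≡.trans (cong ℤ.-_ (e i)) (≡.sym (coeff-negP p' i)))

+P-comm : ∀ p r → p +P r ≋ r +P p
+P-comm p r = mk≋ λ i →
  ≡.trans (coeff-+P p r i) (≡.trans (ℤP.+-comm (coeff p i) _) (≡.sym (coeff-+P r p i)))

+P-assoc : ∀ p r s → (p +P r) +P s ≋ p +P (r +P s)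
+P-assoc p r s = mk≋ λ i → begin
  coeff ((p +P r) +P s) i                 ≡⟨ coeff-+P (p +P r) s i ⟩
  coeff (p +P r) i ℤ.+ coeff s i          ≡⟨ cong (ℤ._+ coeff s i) (coeff-+P p r i) ⟩
  coeff p i ℤ.+ coeff r i ℤ.+ coeff s i   ≡⟨ ℤP.+-assoc (coeff p i) _ _ ⟩
  coeff p i ℤ.+ (coeff r i ℤ.+ coeff s i) ≡⟨ cong (λ z → coeff p i ℤ.+ z) (coeff-+P r s i) ⟨
  coeff p i ℤ.+ coeff (r +P s) i          ≡⟨ coeff-+P p (r +P s) i ⟨
  coeff (p +P (r +P s)) i                 ∎
  where open ≡.≡-Reasoning

+P-identityʳ : ∀ p → p +P [] ≋ p
+P-identityʳ []      = ≋-refl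
+P-identityʳ (a ∷ p) = ≋-refl

+P-inverseˡ : ∀ p → negP p +P p ≋ []
+P-inverseˡ p = mk≋ λ i →
  ≡.trans (coeff-+P (negP p) p i)
          (≡.trans (cong (ℤ._+ coeff p i) (coeff-negP p i)) (ℤP.+-inverseˡ (coeff p i)))

+P-inverseʳ : ∀ p → p +P negP p ≋ []
+P-inverseʳ p = ≋-trans (+P-comm p (negP p)) (+P-inverseˡ p)

*P-zeroˡ : ∀ {p} r → p ≋ [] → p *P r ≋ []
*P-zeroˡ {[]}    r _        = ≋-refl
*P-zeroˡ {a ∷ p} r (mk≋ e) = mk≋ λ i → begin
  coeff ((a ∷ p) *P r) i                         ≡⟨ coeff-∷*P a p r i ⟩
  a ℤ.* coeff r i ℤ.+ coeff (+ 0 ∷ p *P r) i     ≡⟨ cong₂ (λ x y → x ℤ.* coeff r i ℤ.+ y) (e 0)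
                                                      (coeff-≡ (∷-cong refl (*P-zeroˡ {p} r (mk≋ λ i → e (suc i)))) i) ⟩
  + 0 ℤ.* coeff r i ℤ.+ coeff (+ 0 ∷ []) i       ≡⟨ ≡.trans (ℤP.+-identityˡ _) (coeff-≡ [0]≋[] i) ⟩
  + 0                                            ∎
  where open ≡.≡-Reasoning

*P-congˡ : ∀ {p p'} r → p ≋ p' → p *P r ≋ p' *P r
*P-congˡ {[]}    {[]}      r e = ≋-refl
*P-congˡ {[]}    {a' ∷ p'} r e = ≋-sym (*P-zeroˡ r (≋-sym e))
*P-congˡ {a ∷ p} {[]}      r e = *P-zeroˡ r e
*P-congˡ {a ∷ p} {a' ∷ p'} r (mk≋ e) = mk≋ λ i →
  ≡.trans (coeff-∷*P a p r i)
    (≡.trans (cong₂ (λ x y → x ℤ.* coeff r i ℤ.+ y) (e 0)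
               (coeff-≡ (∷-cong refl (*P-congˡ r (∷-injectiveʳ (mk≋ e)))) i))
      (≡.sym (coeff-∷*P a' p' r i)))

*P-congʳ : ∀ p {r r'} → r ≋ r' → p *P r ≋ p *P r'
*P-congʳ []      e = ≋-refl
*P-congʳ (a ∷ p) {r} {r'} (mk≋ e) = mk≋ λ i →
  ≡.trans (coeff-∷*P a p r i)
    (≡.trans (cong₂ (λ x y → a ℤ.* x ℤ.+ y) (e i) (coeff-≡ (∷-cong refl (*P-congʳ p (mk≋ e))) i))
      (≡.sym (coeff-∷*P a p r' i)))

*P-cong : ∀ {p p' r r'} → p ≋ p' → r ≋ r' → p *P r ≋ p' *P r'
*P-cong {p' = p'} {r = r} e f = ≋-trans (*P-congˡ r e) (*P-congʳ p' f)

*P-zeroʳ : ∀ p → p *P [] ≋ []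
*P-zeroʳ []      = ≋-refl
*P-zeroʳ (a ∷ p) = mk≋ λ
  { zero    → refl
  ; (suc i) → coeff-≡ (*P-zeroʳ p) i }

*P-∷ʳ : ∀ p b r → p *P (b ∷ r) ≋ scaleP b p +P (+ 0 ∷ p *P r)
*P-∷ʳ []      b r = mk≋ λ { zero → refl ; (suc i) → refl }
*P-∷ʳ (a ∷ p) b r = mk≋ λ
  { zero    → ≡.trans (ℤP.+-identityʳ _) (≡.trans (ℤP.*-comm a b) (≡.sym (ℤP.+-identityʳ _)))
  ; (suc i) → begin
      coeff (scaleP a r +P p *P (b ∷ r)) i
        ≡⟨ coeff-+P (scaleP a r) _ i ⟩
      coeff (scaleP a r) i ℤ.+ coeff (p *P (b ∷ r)) i
        ≡⟨ cong (λ z → coeff (scaleP a r) i ℤ.+ z) (≡.trans (coeff-≡ (*P-∷ʳ p b r) i) (coeff-+P (scaleP b p) _ i)) ⟩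
      coeff (scaleP a r) i ℤ.+ (coeff (scaleP b p) i ℤ.+ coeff (+ 0 ∷ p *P r) i)
        ≡⟨ swap (coeff (scaleP a r) i) (coeff (scaleP b p) i) _ ⟩
      coeff (scaleP b p) i ℤ.+ (coeff (scaleP a r) i ℤ.+ coeff (+ 0 ∷ p *P r) i)
        ≡⟨ cong (λ z → coeff (scaleP b p) i ℤ.+ z) (coeff-+P (scaleP a r) _ i) ⟨
      coeff (scaleP b p) i ℤ.+ coeff (scaleP a r +P (+ 0 ∷ p *P r)) i
        ≡⟨ coeff-+P (scaleP b p) _ i ⟨
      coeff (scaleP b p +P (scaleP a r +P (+ 0 ∷ p *P r))) i ∎ }
  where
  open ≡.≡-Reasoning
  swap : ∀ x y z → x ℤ.+ (y ℤ.+ z) ≡ y ℤ.+ (x ℤ.+ z)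
  swap = ℤSolver.solve-∀

*P-comm : ∀ p r → p *P r ≋ r *P p
*P-comm []      r = ≋-sym (*P-zeroʳ r)
*P-comm (a ∷ p) r = ≋-sym (≋-trans (*P-∷ʳ r a p) (+P-congʳ (scaleP a r) (∷-cong refl (*P-comm r p))))

*P-distribʳ : ∀ p r s → (p +P r) *P s ≋ p *P s +P r *P s
*P-distribʳ []      r       s = ≋-refl
*P-distribʳ (a ∷ p) []      s = ≋-sym (+P-identityʳ _)
*P-distribʳ (a ∷ p) (b ∷ r) s = mk≋ λ i → begin
  coeff (((a ℤ.+ b) ∷ p +P r) *P s) i
    ≡⟨ coeff-∷*P (a ℤ.+ b) (p +P r) s i ⟩
  (a ℤ.+ b) ℤ.* coeff s i ℤ.+ coeff (+ 0 ∷ (p +P r) *P s) i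
    ≡⟨ cong (λ z → (a ℤ.+ b) ℤ.* coeff s i ℤ.+ z)
         (≡.trans (coeff-≡ (∷-cong refl (*P-distribʳ p r s)) i) (coeff-+P (+ 0 ∷ p *P s) (+ 0 ∷ r *P s) i)) ⟩
  (a ℤ.+ b) ℤ.* coeff s i ℤ.+ (coeff (+ 0 ∷ p *P s) i ℤ.+ coeff (+ 0 ∷ r *P s) i)
    ≡⟨ distrib a b (coeff s i) _ _ ⟩
  (a ℤ.* coeff s i ℤ.+ coeff (+ 0 ∷ p *P s) i) ℤ.+ (b ℤ.* coeff s i ℤ.+ coeff (+ 0 ∷ r *P s) i)
    ≡⟨ cong₂ ℤ._+_ (coeff-∷*P a p s i) (coeff-∷*P b r s i) ⟨
  coeff ((a ∷ p) *P s) i ℤ.+ coeff ((b ∷ r) *P s) i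
    ≡⟨ coeff-+P ((a ∷ p) *P s) _ i ⟨
  coeff ((a ∷ p) *P s +P (b ∷ r) *P s) i ∎
  where
  open ≡.≡-Reasoning
  distrib : ∀ a b s x y → (a ℤ.+ b) ℤ.* s ℤ.+ (x ℤ.+ y) ≡ (a ℤ.* s ℤ.+ x) ℤ.+ (b ℤ.* s ℤ.+ y)
  distrib = ℤSolver.solve-∀

*P-distribˡ : ∀ p r s → p *P (r +P s) ≋ p *P r +P p *P s
*P-distribˡ p r s =
  ≋-trans (*P-comm p _) (≋-trans (*P-distribʳ r s p) (+P-cong (*P-comm r p) (*P-comm s p)))

scaleP-*P : ∀ a r s → scaleP a r *P s ≋ scaleP a (r *P s)
scaleP-*P a []      s = ≋-refl
scaleP-*P a (b ∷ r) s = mk≋ λ i → begin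
  coeff ((a ℤ.* b ∷ scaleP a r) *P s) i
    ≡⟨ coeff-∷*P (a ℤ.* b) (scaleP a r) s i ⟩
  a ℤ.* b ℤ.* coeff s i ℤ.+ coeff (+ 0 ∷ scaleP a r *P s) i
    ≡⟨ cong (λ z → a ℤ.* b ℤ.* coeff s i ℤ.+ z) (coeff-≡ (∷-cong (≡.sym (ℤP.*-zeroʳ a)) (scaleP-*P a r s)) i) ⟩
  a ℤ.* b ℤ.* coeff s i ℤ.+ coeff (scaleP a (+ 0 ∷ r *P s)) i
    ≡⟨ cong (λ z → a ℤ.* b ℤ.* coeff s i ℤ.+ z) (coeff-scaleP a (+ 0 ∷ r *P s) i) ⟩
  a ℤ.* b ℤ.* coeff s i ℤ.+ a ℤ.* coeff (+ 0 ∷ r *P s) i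
    ≡⟨ factor a b (coeff s i) _ ⟩
  a ℤ.* (b ℤ.* coeff s i ℤ.+ coeff (+ 0 ∷ r *P s) i)
    ≡⟨ cong (a ℤ.*_) (coeff-∷*P b r s i) ⟨
  a ℤ.* coeff ((b ∷ r) *P s) i
    ≡⟨ coeff-scaleP a ((b ∷ r) *P s) i ⟨
  coeff (scaleP a ((b ∷ r) *P s)) i ∎
  where
  open ≡.≡-Reasoning
  factor : ∀ a b s x → a ℤ.* b ℤ.* s ℤ.+ a ℤ.* x ≡ a ℤ.* (b ℤ.* s ℤ.+ x)
  factor = ℤSolver.solve-∀

0∷-*P : ∀ p s → (+ 0 ∷ p) *P s ≋ + 0 ∷ p *P s
0∷-*P p s = mk≋ λ i → ≡.trans (coeff-∷*P (+ 0) p s i) (ℤP.+-identityˡ _)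

*P-assoc : ∀ p r s → (p *P r) *P s ≋ p *P (r *P s)
*P-assoc []      r s = ≋-refl
*P-assoc (a ∷ p) r s =
  ≋-trans (*P-distribʳ (scaleP a r) (+ 0 ∷ p *P r) s)
    (+P-cong (scaleP-*P a r s) (≋-trans (0∷-*P (p *P r) s) (∷-cong refl (*P-assoc p r s))))

*P-identityˡ : ∀ p → oneP *P p ≋ p
*P-identityˡ p = mk≋ λ i →
  ≡.trans (coeff-∷*P (+ 1) [] p i)
    (≡.trans (cong₂ ℤ._+_ (ℤP.*-identityˡ (coeff p i)) (coeff-≡ [0]≋[] i)) (ℤP.+-identityʳ _))

*P-identityʳ : ∀ p → p *P oneP ≋ p
*P-identityʳ p = ≋-trans (*P-comm p oneP) (*P-identityˡ p)

-- The ring solver can only cancel terms such as p - p with a zero test.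
≋[]? : ∀ p → Maybe ([] ≋ p)
≋[]? []      = just ≋-refl
≋[]? (a ∷ p) with + 0 ℤP.≟ a | ≋[]? p
... | yes 0≡a | just []≋p = just (mk≋ λ { zero → 0≡a ; (suc i) → coeff-≡ []≋p i })
... | _       | _         = nothing

module CongruenceRing
  (_~_ : Rel Poly 0ℓ) (≋⇒~ : ∀ {p r} → p ≋ r → p ~ r)
  (~-sym : ∀ {p r} → p ~ r → r ~ p) (~-trans : ∀ {p r s} → p ~ r → r ~ s → p ~ s)
  (+P-~cong : ∀ {p p' r r'} → p ~ p' → r ~ r' → (p +P r) ~ (p' +P r'))
  (*P-~cong : ∀ {p p' r r'} → p ~ p' → r ~ r' → (p *P r) ~ (p' *P r'))
  (negP-~cong : ∀ {p p'} → p ~ p' → negP p ~ negP p')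
  where

  ring : CommutativeRing 0ℓ 0ℓ
  ring = record
    { Carrier = Poly ; _≈_ = _~_ ; _+_ = _+P_ ; _*_ = _*P_ ; -_ = negP ; 0# = [] ; 1# = oneP
    ; isCommutativeRing = record
      { isRing = record
        { +-isAbelianGroup = record
          { isGroup = record
            { isMonoid = record
              { isSemigroup = record
                { isMagma = record
                  { isEquivalence = record { refl = ≋⇒~ ≋-refl ; sym = ~-sym ; trans = ~-trans }
                  ; ∙-cong = +P-~cong }
                ; assoc = λ p r s → ≋⇒~ (+P-assoc p r s) }
              ; identity = (λ p → ≋⇒~ ≋-refl) , (λ p → ≋⇒~ (+P-identityʳ p)) }
            ; inverse = (λ p → ≋⇒~ (+P-inverseˡ p)) , (λ p → ≋⇒~ (+P-inverseʳ p))
            ; ⁻¹-cong = negP-~cong }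
          ; comm = λ p r → ≋⇒~ (+P-comm p r) }
        ; *-cong = *P-~cong
        ; *-assoc = λ p r s → ≋⇒~ (*P-assoc p r s)
        ; *-identity = (λ p → ≋⇒~ (*P-identityˡ p)) , (λ p → ≋⇒~ (*P-identityʳ p))
        ; distrib = (λ p r s → ≋⇒~ (*P-distribˡ p r s)) , (λ p r s → ≋⇒~ (*P-distribʳ r s p)) }
      ; *-comm = λ p r → ≋⇒~ (*P-comm p r) } }

  almostRing : ACR.AlmostCommutativeRing 0ℓ 0ℓ
  almostRing = ACR.fromCommutativeRing ring λ p → map ≋⇒~ (≋[]? p)

  open CommutativeRing ring public using (setoid)

module ≋ = CongruenceRing _≋_ (λ e → e) ≋-sym ≋-trans +P-cong *P-cong negP-cong
module ≋-Reasoning = SetoidReasoning ≋.setoid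

≋-almostRing : ACR.AlmostCommutativeRing 0ℓ 0ℓ
≋-almostRing = ≋.almostRing

constP-*P : ∀ a p → constP a *P p ≋ scaleP a p
constP-*P a p = ≋-trans (+P-congʳ (scaleP a p) [0]≋[]) (+P-identityʳ (scaleP a p))

constP-*P-constP : ∀ x y → constP x *P constP y ≋ constP (x ℤ.* y)
constP-*P-constP x y = mk≋ λ { zero → ℤP.+-identityʳ (x ℤ.* y) ; (suc i) → refl }

constP-collect : ∀ Q x b c y →
  Q *P constP x +P (constP b *P constP c) *P (Q *P constP y) ≋ Q *P constP (x ℤ.+ (b ℤ.* c) ℤ.* y)
constP-collect Q x b c y = begin
  Q *P constP x +P (constP b *P constP c) *P (Q *P constP y)   ≈⟨ factor Q (constP x) (constP b *P constP c) (constP y) ⟩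
  Q *P (constP x +P (constP b *P constP c) *P constP y)
    ≈⟨ *P-congʳ Q (+P-congʳ (constP x)
         (≋-trans (*P-congˡ (constP y) (constP-*P-constP b c)) (constP-*P-constP (b ℤ.* c) y))) ⟩
  Q *P constP (x ℤ.+ (b ℤ.* c) ℤ.* y)                          ∎
  where
  open ≋-Reasoning
  factor : ∀ Q A D B → Q *P A +P D *P (Q *P B) ≋ Q *P (A +P D *P B)
  factor = solve-∀ ≋-almostRing

X : Poly
X = monoP 1

0∷≋X*P : ∀ p → + 0 ∷ p ≋ X *P p
0∷≋X*P p = ≋-sym (+P-cong scaleP-0 (∷-cong refl (*P-identityˡ p)))
  where
  scaleP-0 : scaleP (+ 0) p ≋ []
  scaleP-0 = mk≋ λ i → ≡.trans (coeff-scaleP (+ 0) p i) (ℤP.*-zeroˡ (coeff p i))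

monoP-suc : ∀ n → monoP (suc n) ≋ X *P monoP n
monoP-suc n = 0∷≋X*P (monoP n)

monoP-+ : ∀ a b → monoP (a + b) ≋ monoP a *P monoP b
monoP-+ zero    b = ≋-sym (*P-identityˡ (monoP b))
monoP-+ (suc a) b = begin
  monoP (suc a + b)              ≈⟨ monoP-suc (a + b) ⟩
  X *P monoP (a + b)             ≈⟨ *P-congʳ X (monoP-+ a b) ⟩
  X *P (monoP a *P monoP b)      ≈⟨ *P-assoc X (monoP a) (monoP b) ⟨
  (X *P monoP a) *P monoP b      ≈⟨ *P-congˡ (monoP b) (monoP-suc a) ⟨
  monoP (suc a) *P monoP b       ∎
  where open ≋-Reasoning

qint-suc : ∀ n → qint (suc n) ≋ oneP +P X *P qint n
qint-suc n = begin
  qint (suc n)                   ≈⟨ mk≋ (λ { zero → refl ; (suc i) → refl }) ⟩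
  oneP +P (+ 0 ∷ qint n)         ≈⟨ +P-congʳ oneP (0∷≋X*P (qint n)) ⟩
  oneP +P X *P qint n            ∎
  where open ≋-Reasoning

qint-+ : ∀ a b → qint (a + b) ≋ qint a +P monoP a *P qint b
qint-+ zero    b = ≋-sym (*P-identityˡ (qint b))
qint-+ (suc a) b = begin
  qint (suc (a + b))                                 ≈⟨ qint-suc (a + b) ⟩
  oneP +P X *P qint (a + b)                          ≈⟨ +P-congʳ oneP (*P-congʳ X (qint-+ a b)) ⟩
  oneP +P X *P (qint a +P monoP a *P qint b)         ≈⟨ rearrange (qint a) (qint b) (monoP a) ⟩
  (oneP +P X *P qint a) +P (X *P monoP a) *P qint b  ≈⟨ +P-cong (qint-suc a) (*P-congˡ (qint b) (monoP-suc a)) ⟨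
  qint (suc a) +P monoP (suc a) *P qint b            ∎
  where
  open ≋-Reasoning
  rearrange : ∀ A B M → oneP +P X *P (A +P M *P B) ≋ (oneP +P X *P A) +P (X *P M) *P B
  rearrange = solve-∀ ≋-almostRing

qbinom : ℕ → ℕ → Poly
qbinom n       zero    = oneP
qbinom zero    (suc k) = []
qbinom (suc n) (suc k) = qbinom n k +P monoP (suc k) *P qbinom n (suc k)

qbinom-over : ∀ {n k} → n < k → qbinom n k ≋ []
qbinom-over {zero}  {suc k} _         = ≋-refl
qbinom-over {suc n} {suc k} (s≤s n<k) =
  +P-cong (qbinom-over n<k)
    (≋-trans (*P-congʳ (monoP (suc k)) (qbinom-over (ℕP.m<n⇒m<1+n n<k))) (*P-zeroʳ (monoP (suc k))))

qbinom-diag : ∀ n → qbinom n n ≋ oneP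
qbinom-diag zero    = ≋-refl
qbinom-diag (suc n) =
  ≋-trans (+P-cong (qbinom-diag n)
            (≋-trans (*P-congʳ (monoP (suc n)) (qbinom-over (ℕP.n<1+n n))) (*P-zeroʳ (monoP (suc n)))))
          (+P-identityʳ oneP)

qbinom-pascal′ : ∀ a b {n} → b + a ≡ n →
                 qbinom (suc n) (suc b) ≋ monoP a *P qbinom n b +P qbinom n (suc b)
qbinom-pascal′ zero     zero     refl = mk≋ λ { zero → refl ; (suc zero) → refl ; (suc (suc i)) → refl }
qbinom-pascal′ (suc a)  zero     refl = begin
  oneP +P X *P qbinom (suc a) 1                     ≈⟨ +P-congʳ oneP (*P-congʳ X (qbinom-pascal′ a zero refl)) ⟩
  oneP +P X *P (monoP a *P oneP +P qbinom a 1)      ≈⟨ rearrange (monoP a) (qbinom a 1) ⟩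
  (X *P monoP a) *P oneP +P (oneP +P X *P qbinom a 1) ≈⟨ +P-congˡ _ (*P-congˡ oneP (monoP-suc a)) ⟨
  monoP (suc a) *P oneP +P qbinom (suc a) 1         ∎
  where
  open ≋-Reasoning
  rearrange : ∀ M Q → oneP +P X *P (M *P oneP +P Q) ≋ (X *P M) *P oneP +P (oneP +P X *P Q)
  rearrange = solve-∀ ≋-almostRing
qbinom-pascal′ zero     (suc b)  refl rewrite ℕP.+-identityʳ b = begin
  qbinom (suc (suc b)) (suc (suc b))                             ≈⟨ qbinom-diag (suc (suc b)) ⟩
  oneP                                                           ≈⟨ qbinom-diag (suc b) ⟨
  qbinom (suc b) (suc b)                                         ≈⟨ +P-identityʳ _ ⟨
  qbinom (suc b) (suc b) +P []
    ≈⟨ +P-cong (*P-identityˡ _) (qbinom-over (ℕP.n<1+n (suc b))) ⟨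
  monoP 0 *P qbinom (suc b) (suc b) +P qbinom (suc b) (suc (suc b)) ∎
  where open ≋-Reasoning
qbinom-pascal′ (suc a)  (suc b)  refl = begin
  qbinom (suc n) (suc b) +P Mb2 *P qbinom (suc n) (suc (suc b))
    ≈⟨ +P-cong (qbinom-pascal′ (suc a) b refl) (*P-congʳ Mb2 (qbinom-pascal′ a (suc b) (≡.sym (ℕP.+-suc b a)))) ⟩
  (Ma *P A +P B) +P Mb2 *P (Ma' *P B +P C)
    ≈⟨ regroup Ma A B Mb2 Ma' C ⟩
  (Ma *P A +P B) +P (Mb2 *P Ma') *P B +P Mb2 *P C
    ≈⟨ +P-congˡ (Mb2 *P C) (+P-congʳ (Ma *P A +P B) (*P-congˡ B exponents)) ⟩
  (Ma *P A +P B) +P (Ma *P Mb1) *P B +P Mb2 *P C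
    ≈⟨ regroup′ Ma A B Mb2 Mb1 C ⟩
  Ma *P (A +P Mb1 *P B) +P (B +P Mb2 *P C) ∎
  where
  open ≋-Reasoning
  n = b + suc a
  Ma = monoP (suc a)
  Ma' = monoP a
  Mb1 = monoP (suc b)
  Mb2 = monoP (suc (suc b))
  A = qbinom n b
  B = qbinom n (suc b)
  C = qbinom n (suc (suc b))
  exponents : Mb2 *P Ma' ≋ Ma *P Mb1
  exponents = ≋-trans (≋-sym (monoP-+ (suc (suc b)) a))
                (≋-trans (≋-reflexive (cong (λ t → monoP (suc t))
                            (≡.trans (cong suc (ℕP.+-comm b a)) (≡.sym (ℕP.+-suc a b)))))
                  (monoP-+ (suc a) (suc b)))
  regroup : ∀ Ma A B Mb2 Ma' C →
            (Ma *P A +P B) +P Mb2 *P (Ma' *P B +P C) ≋ (Ma *P A +P B) +P (Mb2 *P Ma') *P B +P Mb2 *P C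
  regroup = solve-∀ ≋-almostRing
  regroup′ : ∀ Ma A B Mb2 Mb1 C →
             (Ma *P A +P B) +P (Ma *P Mb1) *P B +P Mb2 *P C ≋ Ma *P (A +P Mb1 *P B) +P (B +P Mb2 *P C)
  regroup′ = solve-∀ ≋-almostRing

qfact-qbinom : ∀ a b {n} → b + a ≡ n → qfact n ≋ qbinom n b *P (qfact b *P qfact a)
qfact-qbinom a        zero    refl = ≋-sym (≋-trans (*P-identityˡ (oneP *P qfact a)) (*P-identityˡ (qfact a)))
qfact-qbinom zero     (suc b) refl rewrite ℕP.+-identityʳ b =
  ≋-sym (≋-trans (*P-cong (qbinom-diag (suc b)) (*P-identityʳ (qfact (suc b)))) (*P-identityˡ (qfact (suc b))))
qfact-qbinom (suc a)  (suc b) refl = begin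
  F *P qint (suc n)                 ≈⟨ *P-congʳ F (qint-+ (suc b) (suc a)) ⟩
  F *P (ib +P M *P ia)              ≈⟨ expand F ib M ia ⟩
  F *P ib +P M *P (F *P ia)         ≈⟨ +P-cong (*P-congˡ ib (qfact-qbinom (suc a) b refl))
                                               (*P-congʳ M (*P-congˡ ia (qfact-qbinom a (suc b) (≡.sym (ℕP.+-suc b a))))) ⟩
  (Q0 *P (fb *P (fa *P ia))) *P ib +P M *P ((Q1 *P ((fb *P ib) *P fa)) *P ia)
                                    ≈⟨ collect ib M ia Q0 fb fa Q1 ⟩
  (Q0 +P M *P Q1) *P ((fb *P ib) *P (fa *P ia)) ∎
  where
  open ≋-Reasoning
  n = b + suc a
  F = qfact n
  ib = qint (suc b)
  ia = qint (suc a)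
  M = monoP (suc b)
  Q0 = qbinom n b
  Q1 = qbinom n (suc b)
  fb = qfact b
  fa = qfact a
  expand : ∀ F ib M ia → F *P (ib +P M *P ia) ≋ F *P ib +P M *P (F *P ia)
  expand = solve-∀ ≋-almostRing
  collect : ∀ ib M ia Q0 fb fa Q1 →
            (Q0 *P (fb *P (fa *P ia))) *P ib +P M *P ((Q1 *P ((fb *P ib) *P fa)) *P ia)
              ≋ (Q0 +P M *P Q1) *P ((fb *P ib) *P (fa *P ia))
  collect = solve-∀ ≋-almostRing

qbinom-absorb : ∀ a b →
  (monoP (suc b) -P oneP) *P qbinom (suc (b + a)) (suc b) ≋ (monoP (suc (b + a)) -P oneP) *P qbinom (b + a) b
qbinom-absorb a b = begin
  (Mb1 -P oneP) *P Z                         ≈⟨ expand Mb1 Z ⟩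
  Mb1 *P Z -P Z                              ≈⟨ +P-congˡ (negP Z) (*P-congʳ Mb1 (qbinom-pascal′ a b refl)) ⟩
  Mb1 *P (Ma *P A +P B) -P (A +P Mb1 *P B)   ≈⟨ cancel Mb1 Ma A B ⟩
  (Mb1 *P Ma -P oneP) *P A                   ≈⟨ *P-congˡ A (+P-congˡ (negP oneP) (monoP-+ (suc b) a)) ⟨
  (monoP (suc (b + a)) -P oneP) *P A         ∎
  where
  open ≋-Reasoning
  Mb1 = monoP (suc b)
  Ma = monoP a
  A = qbinom (b + a) b
  B = qbinom (b + a) (suc b)
  Z = qbinom (suc (b + a)) (suc b)
  expand : ∀ M Z → (M -P oneP) *P Z ≋ M *P Z -P Z
  expand = solve-∀ ≋-almostRing
  cancel : ∀ Mb1 Ma A B → Mb1 *P (Ma *P A +P B) -P (A +P Mb1 *P B) ≋ (Mb1 *P Ma -P oneP) *P A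
  cancel = solve-∀ ≋-almostRing

module Cq = ScaledPowerProductLaws ≋.ring qbinom

cq : ℕ → Poly
cq = Cq.scaledCoeff

record FracRatio (x : Frac) (r s : Poly) : Set where
  constructor cross
  field cross-≋ : proj₁ x *P s ≋ proj₂ x *P r

fracRatio-cong : ∀ {x r r' s s'} → r ≋ r' → s ≋ s' → FracRatio x r s → FracRatio x r' s'
fracRatio-cong {a , b} r≋r' s≋s' (cross e) = cross $ ≋-trans (*P-congʳ a (≋-sym s≋s')) (≋-trans e (*P-congʳ b r≋r'))

fracRatio-+ : ∀ {x y r t s} → FracRatio x r s → FracRatio y t s → FracRatio (x +F y) (r +P t) s
fracRatio-+ {a , b} {c , d} {r} {t} {s} (cross e) (cross f) = cross $ begin
  (a *P d +P c *P b) *P s          ≈⟨ expand a b c d s ⟩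
  d *P (a *P s) +P b *P (c *P s)   ≈⟨ +P-cong (*P-congʳ d e) (*P-congʳ b f) ⟩
  d *P (b *P r) +P b *P (d *P t)   ≈⟨ collect b d r t ⟩
  (b *P d) *P (r +P t)             ∎
  where
  open ≋-Reasoning
  expand : ∀ a b c d s → (a *P d +P c *P b) *P s ≋ d *P (a *P s) +P b *P (c *P s)
  expand = solve-∀ ≋-almostRing
  collect : ∀ b d r t → d *P (b *P r) +P b *P (d *P t) ≋ (b *P d) *P (r +P t)
  collect = solve-∀ ≋-almostRing

fracRatio-* : ∀ {x y r t s u} → FracRatio x r s → FracRatio y t u → FracRatio (x *F y) (r *P t) (s *P u)
fracRatio-* {a , b} {c , d} {r} {t} {s} {u} (cross e) (cross f) = cross $
  ≋-trans (interchange a c s u) (≋-trans (*P-cong e f) (interchange b r d t))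
  where
  interchange : ∀ a c s u → (a *P c) *P (s *P u) ≋ (a *P s) *P (c *P u)
  interchange = solve-∀ ≋-almostRing

fracRatio-neg : ∀ {x r s} → FracRatio x r s → FracRatio (negF x) (negP r) s
fracRatio-neg {a , b} {r} {s} (cross e) = cross $ ≋-trans (negˡ a s) (≋-trans (negP-cong e) (negʳ b r))
  where
  negˡ : ∀ a s → negP a *P s ≋ negP (a *P s)
  negˡ = solve-∀ ≋-almostRing
  negʳ : ∀ b r → negP (b *P r) ≋ b *P negP r
  negʳ = solve-∀ ≋-almostRing

fracRatio-expand : ∀ {x r s} c → FracRatio x r s → FracRatio x (c *P r) (c *P s)
fracRatio-expand {a , b} {r} {s} c (cross e) = cross $ ≋-trans (swap a c s) (≋-trans (*P-congʳ c e) (≋-sym (swap b c r)))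
  where
  swap : ∀ a c s → a *P (c *P s) ≋ c *P (a *P s)
  swap = solve-∀ ≋-almostRing

cq-isCq : ∀ n → 1 ≤ n → IsCq n (cq n)
cq-isCq n 1≤n = coeff-≡ $
  ≋-trans (*P-comm (cq n) _) (≋-trans (≋-sym (FracRatio.cross-≋ ratio)) (*P-comm (proj₁ (eq n)) (qfact n)))
  where
  ratio : FracRatio (eq n) (cq n) (qfact n)
  ratio = PowerProductAsRatio.ppCoeff-ratio ([] , oneP) (oneP , oneP) _+F_ _*F_ negF ≋.ring qbinom qfact
            FracRatio fracRatio-cong fracRatio-+ fracRatio-* fracRatio-neg fracRatio-expand
            (λ s → cross (≋-sym (*P-zeroʳ oneP))) (cross ≋-refl) (λ n k k≤n → qfact-qbinom (n ∸ k) k (ℕP.m+[n∸m]≡n k≤n))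
            (λ n → oneP , qfact n) (λ n → cross (*P-comm oneP (qfact n))) n 1≤n

module Cℤ = ScaledPowerProductLaws ℤP.+-*-commutativeRing (λ n k → + (n C k))

cℤ : ℕ → ℤ
cℤ = Cℤ.scaledCoeff

fromℤ : ℤ → ℚ
fromℤ z = z / 1

toℚᵘ-fromℤ : ∀ z → ℚ.toℚᵘ (fromℤ z) ℚᵘ.≃ ℚᵘ.mkℚᵘ z 0
toℚᵘ-fromℤ z = ℚP.toℚᵘ-fromℚᵘ (ℚᵘ.mkℚᵘ z 0)

fromℤ-+ : ∀ a b → fromℤ (a ℤ.+ b) ≡ fromℤ a ℚ.+ fromℤ b
fromℤ-+ a b = ℚP.toℚᵘ-injective (ℚᵘP.≃-trans (toℚᵘ-fromℤ (a ℤ.+ b)) (ℚᵘP.≃-sym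
  (ℚᵘP.≃-trans (ℚP.toℚᵘ-homo-+ (fromℤ a) (fromℤ b))
    (ℚᵘP.≃-trans (ℚᵘP.+-cong (toℚᵘ-fromℤ a) (toℚᵘ-fromℤ b)) (ℚᵘ.*≡* (normalise a b))))))
  where
  normalise : ∀ a b → (a ℤ.* + 1 ℤ.+ b ℤ.* + 1) ℤ.* + 1 ≡ (a ℤ.+ b) ℤ.* (+ 1 ℤ.* + 1)
  normalise = ℤSolver.solve-∀

fromℤ-* : ∀ a b → fromℤ (a ℤ.* b) ≡ fromℤ a ℚ.* fromℤ b
fromℤ-* a b = ℚP.toℚᵘ-injective (ℚᵘP.≃-trans (toℚᵘ-fromℤ (a ℤ.* b)) (ℚᵘP.≃-sym
  (ℚᵘP.≃-trans (ℚP.toℚᵘ-homo-* (fromℤ a) (fromℤ b))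
    (ℚᵘP.≃-trans (ℚᵘP.*-cong (toℚᵘ-fromℤ a) (toℚᵘ-fromℤ b)) (ℚᵘ.*≡* (normalise a b))))))
  where
  normalise : ∀ a b → (a ℤ.* b) ℤ.* + 1 ≡ (a ℤ.* b) ℤ.* (+ 1 ℤ.* + 1)
  normalise = ℤSolver.solve-∀

fromℤ-neg : ∀ a → fromℤ (ℤ.- a) ≡ ℚ.- fromℤ a
fromℤ-neg a = ℚP.toℚᵘ-injective (ℚᵘP.≃-trans (toℚᵘ-fromℤ (ℤ.- a)) (ℚᵘP.≃-sym
  (ℚᵘP.≃-trans (ℚP.toℚᵘ-homo‿- (fromℤ a)) (ℚᵘP.≃-trans (ℚᵘP.-‿cong (toℚᵘ-fromℤ a)) (ℚᵘ.*≡* refl)))))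

1/n*n≡1 : ∀ n .{{_ : ℕ.NonZero n}} → (+ 1 / n) ℚ.* fromℤ (+ n) ≡ ℚ.1ℚ
1/n*n≡1 (suc n) = ℚP.toℚᵘ-injective (ℚᵘP.≃-trans (ℚP.toℚᵘ-homo-* (+ 1 / suc n) (fromℤ (+ suc n)))
  (ℚᵘP.≃-trans (ℚᵘP.*-cong (ℚP.toℚᵘ-fromℚᵘ (ℚᵘ.mkℚᵘ (+ 1) n)) (toℚᵘ-fromℤ (+ suc n)))
    (ℚᵘ.*≡* (normalise (+ suc n)))))
  where
  normalise : ∀ x → (+ 1 ℤ.* x) ℤ.* + 1 ≡ + 1 ℤ.* (x ℤ.* + 1)
  normalise = ℤSolver.solve-∀

n!≡nCk*k!*[n∸k]! : ∀ n k → k ≤ n → + (n !) ≡ + (n C k) ℤ.* (+ (k !) ℤ.* + ((n ∸ k) !))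
n!≡nCk*k!*[n∸k]! n k k≤n = begin
  + (n !)                                     ≡⟨ cong +_ (m/n*n≡m (k![n∸k]!∣n! k≤n)) ⟨
  + (n ! ℕ./ (k ! ℕ.* (n ∸ k) !) ℕ.* (k ! ℕ.* (n ∸ k) !))
                                              ≡⟨ cong (λ c → + (c ℕ.* (k ! ℕ.* (n ∸ k) !))) (nCk≡n!/k![n-k]! k≤n) ⟨
  + ((n C k) ℕ.* (k ! ℕ.* (n ∸ k) !))         ≡⟨ ℤP.pos-* (n C k) _ ⟩
  + (n C k) ℤ.* + (k ! ℕ.* (n ∸ k) !)         ≡⟨ cong (+ (n C k) ℤ.*_) (ℤP.pos-* (k !) ((n ∸ k) !)) ⟩
  + (n C k) ℤ.* (+ (k !) ℤ.* + ((n ∸ k) !))   ∎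
  where
  open ≡.≡-Reasoning
  instance _ = k !* (n ∸ k) !≢0

module ℚ* = CommSemigroupProperties (CommutativeMonoid.commutativeSemigroup ℚP.*-1-commutativeMonoid)

record ℚRatio (x : ℚ) (r s : ℤ) : Set where
  constructor cross
  field cross-≡ : x ℚ.* fromℤ s ≡ fromℤ r

ℚRatio-cong : ∀ {x r r' s s'} → r ≡ r' → s ≡ s' → ℚRatio x r s → ℚRatio x r' s'
ℚRatio-cong refl refl e = e

ℚRatio-+ : ∀ {x y r t s} → ℚRatio x r s → ℚRatio y t s → ℚRatio (x ℚ.+ y) (r ℤ.+ t) s
ℚRatio-+ {x} {y} {r} {t} {s} (cross e) (cross f) = cross $
  ≡.trans (ℚP.*-distribʳ-+ (fromℤ s) x y) (≡.trans (cong₂ ℚ._+_ e f) (≡.sym (fromℤ-+ r t)))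

ℚRatio-* : ∀ {x y r t s u} → ℚRatio x r s → ℚRatio y t u → ℚRatio (x ℚ.* y) (r ℤ.* t) (s ℤ.* u)
ℚRatio-* {x} {y} {r} {t} {s} {u} (cross e) (cross f) = cross $
  ≡.trans (cong (x ℚ.* y ℚ.*_) (fromℤ-* s u))
    (≡.trans (ℚ*.interchange x y (fromℤ s) (fromℤ u)) (≡.trans (cong₂ ℚ._*_ e f) (≡.sym (fromℤ-* r t))))

ℚRatio-neg : ∀ {x r s} → ℚRatio x r s → ℚRatio (ℚ.- x) (ℤ.- r) s
ℚRatio-neg {x} {r} {s} (cross e) = cross $
  ≡.trans (≡.sym (ℚP.neg-distribˡ-* x (fromℤ s))) (≡.trans (cong ℚ.-_ e) (≡.sym (fromℤ-neg r)))

ℚRatio-expand : ∀ {x r s} c → ℚRatio x r s → ℚRatio x (c ℤ.* r) (c ℤ.* s)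
ℚRatio-expand {x} {r} {s} c (cross e) = cross $
  ≡.trans (cong (x ℚ.*_) (fromℤ-* c s))
    (≡.trans (ℚ*.x∙yz≈y∙xz x (fromℤ c) (fromℤ s)) (≡.trans (cong (fromℤ c ℚ.*_) e) (≡.sym (fromℤ-* c r))))

cℤ≡cExp : ∀ k → 1 ≤ k → cℤ k / 1 ≡ cExp k
cℤ≡cExp k 1≤k = ≡.sym (≡.trans (ℚP.*-comm (+ (k !) / 1) (eExp k)) (ℚRatio.cross-≡ ratio))
  where
  ratio : ℚRatio (eExp k) (cℤ k) (+ (k !))
  ratio = PowerProductAsRatio.ppCoeff-ratio ℚ.0ℚ ℚ.1ℚ ℚ._+_ ℚ._*_ ℚ.-_
            ℤP.+-*-commutativeRing (λ n k → + (n C k)) (λ n → + (n !))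
            ℚRatio ℚRatio-cong ℚRatio-+ ℚRatio-* ℚRatio-neg ℚRatio-expand
            (λ s → cross (ℚP.*-zeroˡ (fromℤ s))) (cross refl) n!≡nCk*k!*[n∸k]!
            (λ n → (+ 1 / n !) {{n !≢0}}) (λ n → cross (1/n*n≡1 (n !) {{n !≢0}})) k 1≤k

infix 4 _≈_mod_
record _≈_mod_ (p r d : Poly) : Set where
  constructor mod-by
  field
    quotient   : Poly
    quotient-≋ : d *P quotient ≋ p -P r

module Modulo (d : Poly) where

  ≋⇒≈mod : ∀ {p r} → p ≋ r → p ≈ r mod d
  ≋⇒≈mod {p} {r} p≋r = mod-by [] (≋-trans (*P-zeroʳ d) (≋-sym (≋-trans (+P-congˡ (negP r) p≋r) (+P-inverseʳ r))))

  ≈mod-sym : ∀ {p r} → p ≈ r mod d → r ≈ p mod d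
  ≈mod-sym {p} {r} (mod-by w e) = mod-by (negP w) (≋-trans (neg d w) (≋-trans (negP-cong e) (swap p r)))
    where
    neg : ∀ d w → d *P negP w ≋ negP (d *P w)
    neg = solve-∀ ≋-almostRing
    swap : ∀ p r → negP (p -P r) ≋ r -P p
    swap = solve-∀ ≋-almostRing

  ≈mod-trans : ∀ {p r s} → p ≈ r mod d → r ≈ s mod d → p ≈ s mod d
  ≈mod-trans {p} {r} {s} (mod-by w e) (mod-by w' e') =
    mod-by (w +P w') (≋-trans (*P-distribˡ d w w') (≋-trans (+P-cong e e') (telescope p r s)))
    where
    telescope : ∀ p r s → (p -P r) +P (r -P s) ≋ p -P s
    telescope = solve-∀ ≋-almostRing

  +P-≈mod-cong : ∀ {p p' r r'} → p ≈ p' mod d → r ≈ r' mod d → p +P r ≈ p' +P r' mod d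
  +P-≈mod-cong {p} {p'} {r} {r'} (mod-by w e) (mod-by w' e') =
    mod-by (w +P w') (≋-trans (*P-distribˡ d w w') (≋-trans (+P-cong e e') (regroup p p' r r')))
    where
    regroup : ∀ p p' r r' → (p -P p') +P (r -P r') ≋ (p +P r) -P (p' +P r')
    regroup = solve-∀ ≋-almostRing

  *P-≈mod-cong : ∀ {p p' r r'} → p ≈ p' mod d → r ≈ r' mod d → p *P r ≈ p' *P r' mod d
  *P-≈mod-cong {p} {p'} {r} {r'} (mod-by w e) (mod-by w' e') =
    mod-by (w *P r +P p' *P w')
      (≋-trans (expand d w p' r w') (≋-trans (+P-cong (*P-congˡ r e) (*P-congʳ p' e')) (collect p p' r r')))
    where
    expand : ∀ d w p' r w' → d *P (w *P r +P p' *P w') ≋ (d *P w) *P r +P p' *P (d *P w')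
    expand = solve-∀ ≋-almostRing
    collect : ∀ p p' r r' → (p -P p') *P r +P p' *P (r -P r') ≋ p *P r -P p' *P r'
    collect = solve-∀ ≋-almostRing

  negP-≈mod-cong : ∀ {p p'} → p ≈ p' mod d → negP p ≈ negP p' mod d
  negP-≈mod-cong {p} {p'} (mod-by w e) = mod-by (negP w) (≋-trans (neg d w) (≋-trans (negP-cong e) (regroup p p')))
    where
    neg : ∀ d w → d *P negP w ≋ negP (d *P w)
    neg = solve-∀ ≋-almostRing
    regroup : ∀ p p' → negP (p -P p') ≋ negP p -P negP p'
    regroup = solve-∀ ≋-almostRing

  ≈mod-refl : ∀ {p} → p ≈ p mod d
  ≈mod-refl = ≋⇒≈mod ≋-refl

  +P-≈mod-congˡ : ∀ {p p'} r → p ≈ p' mod d → p +P r ≈ p' +P r mod d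
  +P-≈mod-congˡ r e = +P-≈mod-cong e (≈mod-refl {r})

  +P-≈mod-congʳ : ∀ p {r r'} → r ≈ r' mod d → p +P r ≈ p +P r' mod d
  +P-≈mod-congʳ p = +P-≈mod-cong (≈mod-refl {p})

  *P-≈mod-congˡ : ∀ {p p'} r → p ≈ p' mod d → p *P r ≈ p' *P r mod d
  *P-≈mod-congˡ r e = *P-≈mod-cong e (≈mod-refl {r})

  *P-≈mod-congʳ : ∀ p {r r'} → r ≈ r' mod d → p *P r ≈ p *P r' mod d
  *P-≈mod-congʳ p = *P-≈mod-cong (≈mod-refl {p})

  open CongruenceRing (_≈_mod d) ≋⇒≈mod ≈mod-sym ≈mod-trans +P-≈mod-cong *P-≈mod-cong negP-≈mod-cong public
    using () renaming (ring to ≈mod-ring)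

  module ≈mod-Reasoning = SetoidReasoning (CommutativeRing.setoid ≈mod-ring)

  d*P≈0 : ∀ w → d *P w ≈ [] mod d
  d*P≈0 w = mod-by w (≋-sym (+P-identityʳ (d *P w)))

  ≈mod-difference : ∀ {p r} → p -P r ≈ [] mod d → p ≈ r mod d
  ≈mod-difference {p} {r} (mod-by w e) = mod-by w (≋-trans e (+P-identityʳ (p -P r)))

  ≈mod⇒difference : ∀ {p r} → p ≈ r mod d → p -P r ≈ [] mod d
  ≈mod⇒difference {p} {r} (mod-by w e) = mod-by w (≋-trans e (≋-sym (+P-identityʳ (p -P r))))

derivP : Poly → Poly
derivP []      = []
derivP (a ∷ p) = p +P (+ 0 ∷ derivP p)

coeff-derivP : ∀ p i → coeff (derivP p) i ≡ + suc i ℤ.* coeff p (suc i)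
coeff-derivP []      i       = ≡.sym (ℤP.*-zeroʳ (+ suc i))
coeff-derivP (a ∷ p) zero    =
  ≡.trans (coeff-+P p (+ 0 ∷ derivP p) 0) (≡.trans (ℤP.+-identityʳ (coeff p 0)) (≡.sym (ℤP.*-identityˡ (coeff p 0))))
coeff-derivP (a ∷ p) (suc i) =
  ≡.trans (coeff-+P p (+ 0 ∷ derivP p) (suc i))
    (≡.trans (cong (λ z → coeff p (suc i) ℤ.+ z) (coeff-derivP p i)) (1+ (coeff p (suc i)) (+ suc i)))
  where
  1+ : ∀ x n → x ℤ.+ n ℤ.* x ≡ (+ 1 ℤ.+ n) ℤ.* x
  1+ = ℤSolver.solve-∀

derivP-cong : ∀ {p r} → p ≋ r → derivP p ≋ derivP r
derivP-cong {p} {r} (mk≋ e) = mk≋ λ i →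
  ≡.trans (coeff-derivP p i) (≡.trans (cong (+ suc i ℤ.*_) (e (suc i))) (≡.sym (coeff-derivP r i)))

derivP-+P : ∀ p r → derivP (p +P r) ≋ derivP p +P derivP r
derivP-+P p r = mk≋ λ i → begin
  coeff (derivP (p +P r)) i                                     ≡⟨ coeff-derivP (p +P r) i ⟩
  + suc i ℤ.* coeff (p +P r) (suc i)                            ≡⟨ cong (+ suc i ℤ.*_) (coeff-+P p r (suc i)) ⟩
  + suc i ℤ.* (coeff p (suc i) ℤ.+ coeff r (suc i))             ≡⟨ ℤP.*-distribˡ-+ (+ suc i) (coeff p (suc i)) _ ⟩
  + suc i ℤ.* coeff p (suc i) ℤ.+ + suc i ℤ.* coeff r (suc i)   ≡⟨ cong₂ ℤ._+_ (coeff-derivP p i) (coeff-derivP r i) ⟨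
  coeff (derivP p) i ℤ.+ coeff (derivP r) i                     ≡⟨ coeff-+P (derivP p) (derivP r) i ⟨
  coeff (derivP p +P derivP r) i                                ∎
  where open ≡.≡-Reasoning

derivP-scaleP : ∀ a p → derivP (scaleP a p) ≋ scaleP a (derivP p)
derivP-scaleP a p = mk≋ λ i → begin
  coeff (derivP (scaleP a p)) i            ≡⟨ coeff-derivP (scaleP a p) i ⟩
  + suc i ℤ.* coeff (scaleP a p) (suc i)   ≡⟨ cong (+ suc i ℤ.*_) (coeff-scaleP a p (suc i)) ⟩
  + suc i ℤ.* (a ℤ.* coeff p (suc i))      ≡⟨ swap (+ suc i) a (coeff p (suc i)) ⟩
  a ℤ.* (+ suc i ℤ.* coeff p (suc i))      ≡⟨ cong (a ℤ.*_) (coeff-derivP p i) ⟨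
  a ℤ.* coeff (derivP p) i                 ≡⟨ coeff-scaleP a (derivP p) i ⟨
  coeff (scaleP a (derivP p)) i            ∎
  where
  open ≡.≡-Reasoning
  swap : ∀ x y z → x ℤ.* (y ℤ.* z) ≡ y ℤ.* (x ℤ.* z)
  swap = ℤSolver.solve-∀

derivP-*P : ∀ p r → derivP (p *P r) ≋ derivP p *P r +P p *P derivP r
derivP-*P []      r = ≋-refl
derivP-*P (a ∷ p) r = begin
  derivP (scaleP a r +P (+ 0 ∷ p *P r))
    ≈⟨ derivP-+P (scaleP a r) (+ 0 ∷ p *P r) ⟩
  derivP (scaleP a r) +P (p *P r +P (+ 0 ∷ derivP (p *P r)))
    ≈⟨ +P-cong (≋-trans (derivP-scaleP a r) (≋-sym (constP-*P a (derivP r))))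
               (+P-congʳ (p *P r) (≋-trans (0∷≋X*P (derivP (p *P r))) (*P-congʳ X (derivP-*P p r)))) ⟩
  constP a *P derivP r +P (p *P r +P X *P (derivP p *P r +P p *P derivP r))
    ≈⟨ rearrange (constP a) r p (derivP p) (derivP r) ⟩
  (p +P X *P derivP p) *P r +P (constP a *P derivP r +P X *P (p *P derivP r))
    ≈⟨ +P-cong (*P-congˡ r (+P-congʳ p (0∷≋X*P (derivP p))))
               (+P-cong (≋-sym (constP-*P a (derivP r))) (0∷≋X*P (p *P derivP r))) ⟨
  derivP (a ∷ p) *P r +P (scaleP a (derivP r) +P (+ 0 ∷ p *P derivP r)) ∎
  where
  open ≋-Reasoning
  rearrange : ∀ A R P DP DR →
    A *P DR +P (P *P R +P X *P (DP *P R +P P *P DR)) ≋ (P +P X *P DP) *P R +P (A *P DR +P X *P (P *P DR))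
  rearrange = solve-∀ ≋-almostRing

X*derivP-monoP : ∀ n → X *P derivP (monoP n) ≋ constP (+ n) *P monoP n
X*derivP-monoP zero    =
  ≋-trans (*P-congʳ X [0]≋[]) (≋-trans (*P-zeroʳ X) (≋-sym (≋-trans (constP-*P (+ 0) (monoP 0)) [0]≋[])))
X*derivP-monoP (suc n) = begin
  X *P (monoP n +P (+ 0 ∷ derivP (monoP n)))          ≈⟨ *P-congʳ X (+P-congʳ (monoP n) (0∷≋X*P (derivP (monoP n)))) ⟩
  X *P (monoP n +P X *P derivP (monoP n))             ≈⟨ *P-distribˡ X (monoP n) _ ⟩
  X *P monoP n +P X *P (X *P derivP (monoP n))        ≈⟨ +P-cong (monoP-suc n) (*P-congʳ X (≋-sym (X*derivP-monoP n))) ⟨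
  monoP (suc n) +P X *P (constP (+ n) *P monoP n)     ≈⟨ +P-congʳ (monoP (suc n)) (swap X (constP (+ n)) (monoP n)) ⟩
  monoP (suc n) +P constP (+ n) *P (X *P monoP n)     ≈⟨ +P-congʳ (monoP (suc n)) (*P-congʳ (constP (+ n)) (monoP-suc n)) ⟨
  monoP (suc n) +P constP (+ n) *P monoP (suc n)      ≈⟨ collect (monoP (suc n)) (constP (+ n)) ⟩
  (oneP +P constP (+ n)) *P monoP (suc n)             ∎
  where
  open ≋-Reasoning
  swap : ∀ X C M → X *P (C *P M) ≋ C *P (X *P M)
  swap = solve-∀ ≋-almostRing
  collect : ∀ M C → M +P C *P M ≋ (oneP +P C) *P M
  collect = solve-∀ ≋-almostRing

coeff-monoP*P-+ : ∀ m s i → coeff (monoP m *P s) (m + i) ≡ coeff s i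
coeff-monoP*P-+ zero    s i = coeff-≡ (*P-identityˡ s) i
coeff-monoP*P-+ (suc m) s i = ≡.trans (coeff-≡ (0∷-*P (monoP m) s) (suc (m + i))) (coeff-monoP*P-+ m s i)

coeff-monoP*P-< : ∀ m s i → i < m → coeff (monoP m *P s) i ≡ + 0
coeff-monoP*P-< (suc m) s zero    _         = coeff-≡ (0∷-*P (monoP m) s) zero
coeff-monoP*P-< (suc m) s (suc i) (s≤s i<m) =
  ≡.trans (coeff-≡ (0∷-*P (monoP m) s) (suc i)) (coeff-monoP*P-< m s i i<m)

coeff-[qᵐ-1]*P : ∀ m s i → coeff ((monoP m -P oneP) *P s) i ≡ coeff (monoP m *P s) i ℤ.- coeff s i
coeff-[qᵐ-1]*P m s i = begin
  coeff ((monoP m -P oneP) *P s) i                       ≡⟨ coeff-≡ (expand (monoP m) s) i ⟩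
  coeff (monoP m *P s -P s) i                            ≡⟨ coeff-+P (monoP m *P s) (negP s) i ⟩
  coeff (monoP m *P s) i ℤ.+ coeff (negP s) i            ≡⟨ cong (λ z → coeff (monoP m *P s) i ℤ.+ z) (coeff-negP s i) ⟩
  coeff (monoP m *P s) i ℤ.- coeff s i                   ∎
  where
  open ≡.≡-Reasoning
  expand : ∀ M s → (M -P oneP) *P s ≋ M *P s -P s
  expand = solve-∀ ≋-almostRing

-- Multiplication by the monic qᵐ - 1 does not create common divisors of
-- the coefficients: the coefficients of s are recovered from those of
-- (qᵐ - 1) s by the recursion sᵢ = s_{i-m} - [(qᵐ - 1) s]ᵢ.
∣-coeff-[qᵐ-1]*P : ∀ {m} → 1 ≤ m → ∀ {N} s →
                   (∀ i → N ℤ∣ coeff ((monoP m -P oneP) *P s) i) → ∀ i → N ℤ∣ coeff s i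
∣-coeff-[qᵐ-1]*P {m} 1≤m {N} s N∣ = <-rec _ step
  where
  unshift : ∀ i → N ℤ∣ coeff (monoP m *P s) i → N ℤ∣ coeff s i
  unshift i N∣a = ≡.subst (N ℤ∣_) (cancel (coeff (monoP m *P s) i) (coeff s i))
                    (ℤ∣.∣m∣n⇒∣m-n N∣a (≡.subst (N ℤ∣_) (coeff-[qᵐ-1]*P m s i) (N∣ i)))
    where
    cancel : ∀ a b → a ℤ.- (a ℤ.- b) ≡ b
    cancel = ℤSolver.solve-∀
  step : ∀ i → (∀ {j} → j < i → N ℤ∣ coeff s j) → N ℤ∣ coeff s i
  step i IH with i ℕ.<? m
  ... | yes i<m = unshift i (≡.subst (N ℤ∣_) (≡.sym (coeff-monoP*P-< m s i i<m)) (ℤ∣.divides (+ 0) refl))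
  ... | no i≮m with ℕP.m≤n⇒∃[o]m+o≡n (ℕP.≮⇒≥ i≮m)
  ...   | o , refl = unshift (m + o) (≡.subst (N ℤ∣_) (≡.sym (coeff-monoP*P-+ m s o)) (IH (ℕP.m<n+m o 1≤m)))

scaleP-quotient : ∀ {N} s → (∀ i → N ℤ∣ coeff s i) → Σ Poly λ w → scaleP N w ≋ s
scaleP-quotient         []      _  = [] , ≋-refl
scaleP-quotient {N} (a ∷ s) N∣ with scaleP-quotient s (λ i → N∣ (suc i))
... | w , N*w≋s = ℤ∣.quotient (N∣ 0) ∷ w ,
                  ∷-cong (≡.sym (≡.trans (ℤ∣._∣_.equality (N∣ 0)) (ℤP.*-comm _ N))) N*w≋s

scaleP-cancel : ∀ N .{{_ : ℤ.NonZero N}} {p r} → scaleP N p ≋ scaleP N r → p ≋ r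
scaleP-cancel N {p} {r} (mk≋ e) = mk≋ λ i → ℤP.*-cancelˡ-≡ N (coeff p i) (coeff r i)
  (≡.trans (≡.sym (coeff-scaleP N p i)) (≡.trans (e i) (coeff-scaleP N r i)))

*P-scaleP : ∀ a p r → p *P scaleP a r ≋ scaleP a (p *P r)
*P-scaleP a p r = begin
  p *P scaleP a r            ≈⟨ *P-congʳ p (constP-*P a r) ⟨
  p *P (constP a *P r)       ≈⟨ swap (constP a) p r ⟩
  constP a *P (p *P r)       ≈⟨ constP-*P a (p *P r) ⟩
  scaleP a (p *P r)          ∎
  where
  open ≋-Reasoning
  swap : ∀ C p r → p *P (C *P r) ≋ C *P (p *P r)
  swap = solve-∀ ≋-almostRing

-- For a factorisation d H = qᵐ - 1, the factors d and H are coprime: from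
-- (qᵐ - 1)' = m qᵐ⁻¹ one gets m ∈ (d, H) up to the unit q, and the
-- remaining factor m is removed using that qᵐ - 1 is monic.
module FactorOf[qᵐ-1] {d H : Poly} {m : ℕ} (1≤m : 1 ≤ m) (d*H≋qᵐ-1 : d *P H ≋ monoP m -P oneP) where
  open Modulo d

  qᵐ≈1 : monoP m ≈ oneP mod d
  qᵐ≈1 = mod-by H d*H≋qᵐ-1

  X*derivP-[qᵐ-1] : X *P (derivP d *P H +P d *P derivP H) ≋ constP (+ m) *P monoP m
  X*derivP-[qᵐ-1] = begin
    X *P (derivP d *P H +P d *P derivP H)          ≈⟨ *P-congʳ X (derivP-*P d H) ⟨
    X *P derivP (d *P H)                           ≈⟨ *P-congʳ X (derivP-cong d*H≋qᵐ-1) ⟩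
    X *P derivP (monoP m -P oneP)                  ≈⟨ *P-congʳ X (derivP-+P (monoP m) (negP oneP)) ⟩
    X *P (derivP (monoP m) +P (+ 0 ∷ []))          ≈⟨ *P-congʳ X (≋-trans (+P-congʳ _ [0]≋[]) (+P-identityʳ _)) ⟩
    X *P derivP (monoP m)                          ≈⟨ X*derivP-monoP m ⟩
    constP (+ m) *P monoP m                        ∎
    where open ≋-Reasoning

  H*y≈0⇒m*y≈0 : ∀ y → H *P y ≈ [] mod d → constP (+ m) *P y ≈ [] mod d
  H*y≈0⇒m*y≈0 y H*y≈0 = begin
    constP (+ m) *P y                                  ≈⟨ ≋⇒≈mod (*P-congʳ (constP (+ m)) (*P-identityˡ y)) ⟨
    constP (+ m) *P (oneP *P y)                        ≈⟨ *P-≈mod-congʳ (constP (+ m)) (*P-≈mod-congˡ y (≈mod-sym qᵐ≈1)) ⟩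
    constP (+ m) *P (monoP m *P y)
      ≈⟨ ≋⇒≈mod (≋-trans (*P-congˡ y X*derivP-[qᵐ-1]) (*P-assoc (constP (+ m)) (monoP m) y)) ⟨
    (X *P (derivP d *P H +P d *P derivP H)) *P y       ≈⟨ ≋⇒≈mod (expand (derivP d) d H (derivP H) y) ⟩
    (X *P derivP d) *P (H *P y) +P d *P ((X *P derivP H) *P y)
                                                       ≈⟨ +P-≈mod-cong (*P-≈mod-congʳ (X *P derivP d) H*y≈0) (d*P≈0 _) ⟩
    (X *P derivP d) *P [] +P []                        ≈⟨ ≋⇒≈mod (≋-trans (+P-identityʳ _) (*P-zeroʳ (X *P derivP d))) ⟩
    []                                                 ∎
    where
    open ≈mod-Reasoning
    expand : ∀ Dd d H DH y → (X *P (Dd *P H +P d *P DH)) *P y ≋ (X *P Dd) *P (H *P y) +P d *P ((X *P DH) *P y)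
    expand = solve-∀ ≋-almostRing

  m·y≈0⇒y≈0 : ∀ y → scaleP (+ m) y ≈ [] mod d → y ≈ [] mod d
  m·y≈0⇒y≈0 y (mod-by w d*w≋) = mod-by w′ (≋-trans d*w′≋y (≋-sym (+P-identityʳ y)))
    where
    instance
      m≢0 : ℕ.NonZero m
      m≢0 = ℕ.>-nonZero 1≤m
    d*w≋m*y : d *P w ≋ scaleP (+ m) y
    d*w≋m*y = ≋-trans d*w≋ (+P-identityʳ _)
    [qᵐ-1]*w≋m*H*y : (monoP m -P oneP) *P w ≋ scaleP (+ m) (H *P y)
    [qᵐ-1]*w≋m*H*y = begin
      (monoP m -P oneP) *P w     ≈⟨ *P-congˡ w d*H≋qᵐ-1 ⟨
      (d *P H) *P w              ≈⟨ swap d H w ⟩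
      H *P (d *P w)              ≈⟨ *P-congʳ H d*w≋m*y ⟩
      H *P scaleP (+ m) y        ≈⟨ *P-scaleP (+ m) H y ⟩
      scaleP (+ m) (H *P y)      ∎
      where
      open ≋-Reasoning
      swap : ∀ d H w → (d *P H) *P w ≋ H *P (d *P w)
      swap = solve-∀ ≋-almostRing
    m∣w : Σ Poly λ w′ → scaleP (+ m) w′ ≋ w
    m∣w = scaleP-quotient w (∣-coeff-[qᵐ-1]*P 1≤m w λ i → ℤ∣.divides (coeff (H *P y) i)
            (≡.trans (coeff-≡ [qᵐ-1]*w≋m*H*y i) (≡.trans (coeff-scaleP (+ m) (H *P y) i) (ℤP.*-comm (+ m) _))))
    w′ = proj₁ m∣w
    d*w′≋y : d *P w′ ≋ y
    d*w′≋y = scaleP-cancel (+ m)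
               (≋-trans (≋-sym (*P-scaleP (+ m) d w′)) (≋-trans (*P-congʳ d (proj₂ m∣w)) d*w≋m*y))

  cofactor-cancel : ∀ y → H *P y ≈ [] mod d → y ≈ [] mod d
  cofactor-cancel y H*y≈0 =
    m·y≈0⇒y≈0 y (≈mod-trans (≋⇒≈mod (≋-sym (constP-*P (+ m) y))) (H*y≈0⇒m*y≈0 y H*y≈0))

module Cyclotomic (Φ : ℕ → Poly) (cyc : IsCyclotomic Φ) where

  divProd≋qⁿ-1 : ∀ n → 1 ≤ n → divProd Φ n n ≋ monoP n -P oneP
  divProd≋qⁿ-1 n 1≤n = mk≋ (cyc n 1≤n)

  divProd-∣ : ∀ n j → suc j ∣ n → divProd Φ n (suc j) ≡ divProd Φ n j *P Φ (suc j)
  divProd-∣ n j = if-yes (suc j ∣? n)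

  divProd-∤ : ∀ n j → ¬ suc j ∣ n → divProd Φ n (suc j) ≡ divProd Φ n j
  divProd-∤ n j = if-no (suc j ∣? n)

  divProd-beyond : ∀ g t → 1 ≤ g → divProd Φ g (t + g) ≡ divProd Φ g g
  divProd-beyond g zero    _   = refl
  divProd-beyond g (suc t) 1≤g =
    ≡.trans (divProd-∤ g (t + g) λ t+g∣g → ℕP.<⇒≱ (s≤s (ℕP.m≤n+m g t)) (∣⇒≤ {{ℕ.>-nonZero 1≤g}} t+g∣g))
            (divProd-beyond g t 1≤g)

  cofactorProd : ℕ → ℕ → ℕ → Poly
  cofactorProd m g zero    = oneP
  cofactorProd m g (suc j) =
    if does (suc j ∣? m)
    then (if does (suc j ∣? g) then cofactorProd m g j else cofactorProd m g j *P Φ (suc j))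
    else cofactorProd m g j

  divProd-split : ∀ {m g} → g ∣ m → ∀ j → divProd Φ m j ≋ divProd Φ g j *P cofactorProd m g j
  divProd-split g∣m zero = ≋-sym (*P-identityˡ oneP)
  divProd-split {m} {g} g∣m (suc j) with suc j ∣? m | suc j ∣? g
  ... | yes d∣m | yes d∣g = begin
    divProd Φ m (suc j)                          ≡⟨ divProd-∣ m j d∣m ⟩
    divProd Φ m j *P Φ (suc j)                   ≈⟨ *P-congˡ (Φ (suc j)) (divProd-split g∣m j) ⟩
    (divProd Φ g j *P E j) *P Φ (suc j)          ≈⟨ swap (divProd Φ g j) (E j) (Φ (suc j)) ⟩
    (divProd Φ g j *P Φ (suc j)) *P E j
      ≡⟨ cong₂ _*P_ (divProd-∣ g j d∣g) (≡.trans (if-yes (suc j ∣? m) d∣m) (if-yes (suc j ∣? g) d∣g)) ⟨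
    divProd Φ g (suc j) *P E (suc j)             ∎
    where
    open ≋-Reasoning
    E = cofactorProd m g
    swap : ∀ A B C → (A *P B) *P C ≋ (A *P C) *P B
    swap = solve-∀ ≋-almostRing
  ... | yes d∣m | no d∤g = begin
    divProd Φ m (suc j)                          ≡⟨ divProd-∣ m j d∣m ⟩
    divProd Φ m j *P Φ (suc j)                   ≈⟨ *P-congˡ (Φ (suc j)) (divProd-split g∣m j) ⟩
    (divProd Φ g j *P E j) *P Φ (suc j)          ≈⟨ *P-assoc (divProd Φ g j) (E j) (Φ (suc j)) ⟩
    divProd Φ g j *P (E j *P Φ (suc j))
      ≡⟨ cong₂ _*P_ (divProd-∤ g j d∤g) (≡.trans (if-yes (suc j ∣? m) d∣m) (if-no (suc j ∣? g) d∤g)) ⟨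
    divProd Φ g (suc j) *P E (suc j)             ∎
    where
    open ≋-Reasoning
    E = cofactorProd m g
  ... | no d∤m | yes d∣g = ⊥-elim (d∤m (∣-trans d∣g g∣m))
  ... | no d∤m | no d∤g = begin
    divProd Φ m (suc j)                          ≡⟨ divProd-∤ m j d∤m ⟩
    divProd Φ m j                                ≈⟨ divProd-split g∣m j ⟩
    divProd Φ g j *P cofactorProd m g j          ≡⟨ cong₂ _*P_ (divProd-∤ g j d∤g) (if-no (suc j ∣? m) d∤m) ⟨
    divProd Φ g (suc j) *P cofactorProd m g (suc j) ∎
    where open ≋-Reasoning

  module Order (m-1 : ℕ) where
    m : ℕ
    m = suc m-1

    open Modulo (Φ m) public

    Φ*divProd≋qᵐ-1 : Φ m *P divProd Φ m m-1 ≋ monoP m -P oneP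
    Φ*divProd≋qᵐ-1 = begin
      Φ m *P divProd Φ m m-1   ≈⟨ *P-comm (Φ m) _ ⟩
      divProd Φ m m-1 *P Φ m   ≡⟨ divProd-∣ m m-1 ∣-refl ⟨
      divProd Φ m m            ≈⟨ divProd≋qⁿ-1 m (s≤s z≤n) ⟩
      monoP m -P oneP          ∎
      where open ≋-Reasoning

    qᵐ≈1 : monoP m ≈ oneP mod Φ m
    qᵐ≈1 = FactorOf[qᵐ-1].qᵐ≈1 (s≤s z≤n) Φ*divProd≋qᵐ-1

    qᵗᵐ≈1 : ∀ t → monoP (t * m) ≈ oneP mod Φ m
    qᵗᵐ≈1 zero    = ≈mod-refl
    qᵗᵐ≈1 (suc t) = ≈mod-trans (≋⇒≈mod (monoP-+ m (t * m)))
                      (≈mod-trans (*P-≈mod-cong qᵐ≈1 (qᵗᵐ≈1 t)) (≋⇒≈mod (*P-identityˡ oneP)))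

    [qᵏ-1]y≈0⇒qᵏy≈y : ∀ k y → (monoP k -P oneP) *P y ≈ [] mod Φ m → monoP k *P y ≈ y mod Φ m
    [qᵏ-1]y≈0⇒qᵏy≈y k y e = ≈mod-difference (≈mod-trans (≋⇒≈mod (≋-sym (expand (monoP k) y))) e)
      where
      expand : ∀ M y → (M -P oneP) *P y ≋ M *P y -P y
      expand = solve-∀ ≋-almostRing

    module _ {g : ℕ} (g∣m : g ∣ m) (1≤g : 1 ≤ g) (g<m : g < m) where

      Φ*[qᵍ-1]-cofactor : Φ m *P ((monoP g -P oneP) *P cofactorProd m g m-1) ≋ monoP m -P oneP
      Φ*[qᵍ-1]-cofactor = begin
        Φ m *P ((monoP g -P oneP) *P E m-1)    ≈⟨ swap (Φ m) (monoP g -P oneP) (E m-1) ⟩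
        (monoP g -P oneP) *P (E m-1 *P Φ m)    ≈⟨ *P-congˡ (E m-1 *P Φ m) (divProd≋qⁿ-1 g 1≤g) ⟨
        divProd Φ g g *P (E m-1 *P Φ m)        ≡⟨ cong₂ _*P_ g-part m-part ⟨
        divProd Φ g m *P E m                   ≈⟨ divProd-split g∣m m ⟨
        divProd Φ m m                          ≈⟨ divProd≋qⁿ-1 m (s≤s z≤n) ⟩
        monoP m -P oneP                        ∎
        where
        open ≋-Reasoning
        E = cofactorProd m g
        g-part : divProd Φ g m ≡ divProd Φ g g
        g-part = ≡.trans (cong (divProd Φ g) (≡.sym (ℕP.m∸n+n≡m (ℕP.<⇒≤ g<m)))) (divProd-beyond g (m ∸ g) 1≤g)
        m-part : E m ≡ E m-1 *P Φ m
        m-part = ≡.trans (if-yes (m ∣? m) ∣-refl)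
                   (if-no (m ∣? g) λ m∣g → ℕP.<⇒≱ g<m (∣⇒≤ {{ℕ.>-nonZero 1≤g}} m∣g))
        swap : ∀ A B C → A *P (B *P C) ≋ B *P (C *P A)
        swap = solve-∀ ≋-almostRing

      [qᵍ-1]*P-cancel : ∀ y → (monoP g -P oneP) *P y ≈ [] mod Φ m → y ≈ [] mod Φ m
      [qᵍ-1]*P-cancel y e = FactorOf[qᵐ-1].cofactor-cancel (s≤s z≤n) Φ*[qᵍ-1]-cofactor y $ begin
        ((monoP g -P oneP) *P E) *P y    ≈⟨ ≋⇒≈mod (swap (monoP g -P oneP) E y) ⟩
        E *P ((monoP g -P oneP) *P y)    ≈⟨ *P-≈mod-congʳ E e ⟩
        E *P []                          ≈⟨ ≋⇒≈mod (*P-zeroʳ E) ⟩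
        []                               ∎
        where
        open ≈mod-Reasoning
        E = cofactorProd m g m-1
        swap : ∀ A B C → (A *P B) *P C ≋ B *P (A *P C)
        swap = solve-∀ ≋-almostRing

    -- Bézout reduces qᵏ y ≡ y to q^gcd(k,m) y ≡ y, as qᵐ ≡ 1.
    [qᵏ-1]*P-cancel : ∀ {k} → 1 ≤ k → k < m → ∀ y → (monoP k -P oneP) *P y ≈ [] mod Φ m → y ≈ [] mod Φ m
    [qᵏ-1]*P-cancel {k} 1≤k k<m y e with Bézout.lemma k m
    ... | Bézout.result g gcd identity =
      [qᵍ-1]*P-cancel g∣m 1≤g (ℕP.≤-<-trans (∣⇒≤ {{ℕ.>-nonZero 1≤k}} g∣k) k<m) y
        (≈mod-trans (≋⇒≈mod (expand (monoP g) y)) (≈mod⇒difference (qᵍy≈y identity)))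
      where
      g∣k = proj₁ (GCD.commonDivisor gcd)
      g∣m = proj₂ (GCD.commonDivisor gcd)
      1≤g : 1 ≤ g
      1≤g = ℕP.n≢0⇒n>0 λ { refl → ℕP.1+n≢0 (ℕ∣.0∣⇒≡0 g∣m) }
      expand : ∀ M y → (M -P oneP) *P y ≋ M *P y -P y
      expand = solve-∀ ≋-almostRing
      qᵏy≈y = [qᵏ-1]y≈0⇒qᵏy≈y k y e
      qˣᵏy≈y : ∀ x → monoP (x * k) *P y ≈ y mod Φ m
      qˣᵏy≈y zero    = ≋⇒≈mod (*P-identityˡ y)
      qˣᵏy≈y (suc x) = begin
        monoP (k + x * k) *P y            ≈⟨ ≋⇒≈mod (≋-trans (*P-congˡ y (monoP-+ k (x * k))) (*P-assoc (monoP k) _ y)) ⟩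
        monoP k *P (monoP (x * k) *P y)   ≈⟨ *P-≈mod-congʳ (monoP k) (qˣᵏy≈y x) ⟩
        monoP k *P y                      ≈⟨ qᵏy≈y ⟩
        y                                 ∎
        where open ≈mod-Reasoning
      qᵍy≈y : Bézout.Identity g k m → monoP g *P y ≈ y mod Φ m
      qᵍy≈y (Bézout.+- x t g+tm≡xk) = begin
        monoP g *P y                      ≈⟨ *P-≈mod-congˡ y (≋⇒≈mod (*P-identityʳ (monoP g))) ⟨
        (monoP g *P oneP) *P y            ≈⟨ *P-≈mod-congˡ y (*P-≈mod-congʳ (monoP g) (qᵗᵐ≈1 t)) ⟨
        (monoP g *P monoP (t * m)) *P y   ≈⟨ ≋⇒≈mod (*P-congˡ y (monoP-+ g (t * m))) ⟨
        monoP (g + t * m) *P y            ≡⟨ cong (λ i → monoP i *P y) g+tm≡xk ⟩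
        monoP (x * k) *P y                ≈⟨ qˣᵏy≈y x ⟩
        y                                 ∎
        where open ≈mod-Reasoning
      qᵍy≈y (Bézout.-+ x t g+xk≡tm) = begin
        monoP g *P y                      ≈⟨ *P-≈mod-congʳ (monoP g) (qˣᵏy≈y x) ⟨
        monoP g *P (monoP (x * k) *P y)
          ≈⟨ ≋⇒≈mod (≋-trans (*P-congˡ y (monoP-+ g (x * k))) (*P-assoc (monoP g) (monoP (x * k)) y)) ⟨
        monoP (g + x * k) *P y            ≡⟨ cong (λ i → monoP i *P y) g+xk≡tm ⟩
        monoP (t * m) *P y                ≈⟨ *P-≈mod-congˡ y (qᵗᵐ≈1 t) ⟩
        oneP *P y                         ≈⟨ ≋⇒≈mod (*P-identityˡ y) ⟩
        y                                 ∎
        where open ≈mod-Reasoning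

    qᵐ-1≈0 : monoP m -P oneP ≈ [] mod Φ m
    qᵐ-1≈0 = ≈mod⇒difference qᵐ≈1

    qbinom-m≈0 : ∀ {k} → 1 ≤ k → k < m → qbinom m k ≈ [] mod Φ m
    qbinom-m≈0 {suc b} _ (s≤s b<m-1) with ℕP.m≤n⇒∃[o]m+o≡n (ℕP.<⇒≤ b<m-1)
    ... | a , refl = [qᵏ-1]*P-cancel (s≤s z≤n) (s≤s b<m-1) (qbinom m (suc b)) $ begin
      (monoP (suc b) -P oneP) *P qbinom m (suc b)   ≈⟨ ≋⇒≈mod (qbinom-absorb a b) ⟩
      (monoP m -P oneP) *P qbinom (b + a) b         ≈⟨ *P-≈mod-congˡ (qbinom (b + a) b) qᵐ-1≈0 ⟩
      [] *P qbinom (b + a) b                        ≈⟨ ≈mod-refl ⟩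
      []                                            ∎
      where open ≈mod-Reasoning

    qbinom-+m-low : ∀ n {k} → k < m → qbinom (n + m) k ≈ qbinom n k mod Φ m
    qbinom-+m-low zero    {zero}  _   = ≈mod-refl
    qbinom-+m-low zero    {suc k} k<m = qbinom-m≈0 (s≤s z≤n) k<m
    qbinom-+m-low (suc n) {zero}  _   = ≈mod-refl
    qbinom-+m-low (suc n) {suc k} k<m =
      +P-≈mod-cong (qbinom-+m-low n (ℕP.<-trans (ℕP.n<1+n k) k<m))
                   (*P-≈mod-congʳ (monoP (suc k)) (qbinom-+m-low n k<m))

    qbinom-+m-high : ∀ n k → qbinom (n + m) (k + m) ≈ qbinom n (k + m) +P qbinom n k mod Φ m
    qbinom-+m-high zero    zero    = ≋⇒≈mod (qbinom-diag m)
    qbinom-+m-high zero    (suc k) = ≋⇒≈mod (qbinom-over (ℕP.m<n+m m {suc k} (s≤s z≤n)))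
    qbinom-+m-high (suc n) zero    = begin
      qbinom (n + m) m-1 +P monoP m *P qbinom (n + m) m
        ≈⟨ +P-≈mod-cong (qbinom-+m-low n ℕP.≤-refl) (*P-≈mod-congʳ (monoP m) (qbinom-+m-high n zero)) ⟩
      qbinom n m-1 +P monoP m *P (qbinom n m +P oneP)
        ≈⟨ ≋⇒≈mod (regroup (qbinom n m-1) (monoP m) (qbinom n m)) ⟩
      (qbinom n m-1 +P monoP m *P qbinom n m) +P monoP m
        ≈⟨ +P-≈mod-congʳ (qbinom n m-1 +P monoP m *P qbinom n m) qᵐ≈1 ⟩
      (qbinom n m-1 +P monoP m *P qbinom n m) +P oneP ∎
      where
      open ≈mod-Reasoning
      regroup : ∀ A M B → A +P M *P (B +P oneP) ≋ (A +P M *P B) +P M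
      regroup = solve-∀ ≋-almostRing
    qbinom-+m-high (suc n) (suc k) = begin
      qbinom (n + m) (k + m) +P M′ *P qbinom (n + m) (suc k + m)
        ≈⟨ +P-≈mod-cong (qbinom-+m-high n k) (*P-≈mod-congʳ M′ (qbinom-+m-high n (suc k))) ⟩
      (qbinom n (k + m) +P qbinom n k) +P M′ *P (qbinom n (suc k + m) +P qbinom n (suc k))
        ≈⟨ ≋⇒≈mod (regroup (qbinom n (k + m)) (qbinom n k) (qbinom n (suc k + m)) (qbinom n (suc k)) M′) ⟩
      (qbinom n (k + m) +P M′ *P qbinom n (suc k + m)) +P (qbinom n k +P M′ *P qbinom n (suc k))
        ≈⟨ +P-≈mod-congʳ (qbinom n (k + m) +P M′ *P qbinom n (suc k + m))
             (+P-≈mod-congʳ (qbinom n k) (*P-≈mod-congˡ (qbinom n (suc k)) M′≈qᵏ⁺¹)) ⟩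
      (qbinom n (k + m) +P M′ *P qbinom n (suc k + m)) +P (qbinom n k +P monoP (suc k) *P qbinom n (suc k)) ∎
      where
      open ≈mod-Reasoning
      M′ = monoP (suc k + m)
      M′≈qᵏ⁺¹ : M′ ≈ monoP (suc k) mod Φ m
      M′≈qᵏ⁺¹ = ≈mod-trans (≋⇒≈mod (monoP-+ (suc k) m))
                  (≈mod-trans (*P-≈mod-congʳ (monoP (suc k)) qᵐ≈1) (≋⇒≈mod (*P-identityʳ (monoP (suc k)))))
      regroup : ∀ A B C D M → (A +P B) +P M *P (C +P D) ≋ (A +P M *P C) +P (B +P M *P D)
      regroup = solve-∀ ≋-almostRing

    +-*m-suc : ∀ r a → r + a * m + m ≡ r + suc a * m
    +-*m-suc r a = ≡.trans (ℕP.+-assoc r (a * m) m) (cong (λ n → r + n) (ℕP.+-comm (a * m) m))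

    +-*m-∸ : ∀ r k d → (r + (k + d) * m) ∸ k * m ≡ r + d * m
    +-*m-∸ r k d = begin
      (r + (k + d) * m) ∸ k * m           ≡⟨ cong (λ n → (r + n) ∸ k * m) (ℕP.*-distribʳ-+ m k d) ⟩
      (r + (k * m + d * m)) ∸ k * m       ≡⟨ cong (_∸ k * m) (ℕP.+-comm r (k * m + d * m)) ⟩
      (k * m + d * m + r) ∸ k * m         ≡⟨ cong (_∸ k * m) (ℕP.+-assoc (k * m) (d * m) r) ⟩
      (k * m + (d * m + r)) ∸ k * m       ≡⟨ ℕP.m+n∸m≡n (k * m) (d * m + r) ⟩
      d * m + r                           ≡⟨ ℕP.+-comm (d * m) r ⟩
      r + d * m                           ∎
      where open ≡.≡-Reasoning

    qbinom-digit-low : ∀ a {r s} → r < s → s < m → qbinom (r + a * m) s ≈ [] mod Φ m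
    qbinom-digit-low zero    {r} r<s _   = ≋⇒≈mod (qbinom-over (ℕP.≤-trans (s≤s (ℕP.≤-reflexive (ℕP.+-identityʳ r))) r<s))
    qbinom-digit-low (suc a) {r} {s} r<s s<m = begin
      qbinom (r + (m + a * m)) s     ≡⟨ cong (λ n → qbinom n s) (+-*m-suc r a) ⟨
      qbinom (r + a * m + m) s       ≈⟨ qbinom-+m-low (r + a * m) s<m ⟩
      qbinom (r + a * m) s           ≈⟨ qbinom-digit-low a r<s s<m ⟩
      []                             ∎
      where open ≈mod-Reasoning

    q-Lucas : ∀ a i {r} → r < m → qbinom (r + a * m) (i * m) ≈ constP (+ (a C i)) mod Φ m
    q-Lucas zero    zero    _   = ≈mod-refl
    q-Lucas zero    (suc i) {r} r<m = ≋⇒≈mod (≋-trans (qbinom-over r+0<m+im) (≋-sym [0]≋[]))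
      where r+0<m+im = ℕP.<-≤-trans (ℕP.≤-trans (s≤s (ℕP.≤-reflexive (ℕP.+-identityʳ r))) r<m) (ℕP.m≤m+n m (i * m))
    q-Lucas (suc a) zero    _   = ≈mod-refl
    q-Lucas (suc a) (suc i) {r} r<m = begin
      qbinom (r + (m + a * m)) (m + i * m)                   ≡⟨ cong₂ qbinom (+-*m-suc r a) (ℕP.+-comm (i * m) m) ⟨
      qbinom (r + a * m + m) (i * m + m)                     ≈⟨ qbinom-+m-high (r + a * m) (i * m) ⟩
      qbinom (r + a * m) (i * m + m) +P qbinom (r + a * m) (i * m)
                                                             ≡⟨ cong (λ k → qbinom N k +P qbinom N (i * m)) (ℕP.+-comm (i * m) m) ⟩
      qbinom (r + a * m) (suc i * m) +P qbinom (r + a * m) (i * m)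
                                                             ≈⟨ +P-≈mod-cong (q-Lucas a (suc i) r<m) (q-Lucas a i r<m) ⟩
      constP (+ (a C suc i)) +P constP (+ (a C i))           ≡⟨ cong constP (ℤP.pos-+ (a C suc i) (a C i)) ⟨
      constP (+ (a C suc i + a C i))                         ≡⟨ cong (λ c → constP (+ c)) pascal ⟩
      constP (+ (suc a C suc i))                             ∎
      where
      open ≈mod-Reasoning
      N = r + a * m
      pascal : a C suc i + a C i ≡ suc a C suc i
      pascal = ≡.trans (ℕP.+-comm (a C suc i) (a C i)) (nCk+nC[k+1]≡[n+1]C[k+1] a i)

    module Cζ = ScaledPowerProductLaws ≈mod-ring qbinom
    open Cζ using (scaledProd)

    qbinom-diag-≈mod : ∀ n → qbinom n n ≈ oneP mod Φ m
    qbinom-diag-≈mod n = ≋⇒≈mod (qbinom-diag n)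

    expProd : ℕ → ℕ → ℤ
    expProd = Cℤ.scaledProd cℤ

    lowProd : ℕ → Poly
    lowProd = scaledProd cq m-1

    -- The values of c k (ζ m) asserted by the theorem; below m nothing is claimed.
    cζ : ℕ → Poly
    cζ k = if does (k ℕ.<? m) then cq k else (if does (m ∣? k) then constP (cℤ (k ℕ./ m)) else [])

    cζ-< : ∀ {k} → k < m → cζ k ≡ cq k
    cζ-< {k} = if-yes (k ℕ.<? m)

    cζ-multiple : ∀ i → cζ (suc i * m) ≡ constP (cℤ (suc i))
    cζ-multiple i =
      ≡.trans (if-no (suc i * m ℕ.<? m) λ im<m → ℕP.<⇒≱ im<m (ℕP.m≤m+n m (i * m)))
        (≡.trans (if-yes (m ∣? suc i * m) (ℕ∣.n∣m*n (suc i)))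
          (cong (λ k → constP (cℤ k)) (m*n/n≡m (suc i) m)))

    cζ-other : ∀ {k} → ¬ k < m → ¬ m ∣ k → cζ k ≡ []
    cζ-other {k} k≮m m∤k = ≡.trans (if-no (k ℕ.<? m) k≮m) (if-no (m ∣? k) m∤k)

    cζ-between-multiples : ∀ i {t} → t < m-1 → cζ (suc (suc i * m + t)) ≡ []
    cζ-between-multiples i {t} t<m-1 = cζ-other
      (λ k<m → ℕP.<⇒≱ k<m (ℕP.m≤n⇒m≤1+n (ℕP.≤-trans (ℕP.m≤m+n m (i * m)) (ℕP.m≤m+n (suc i * m) t))))
      (λ m∣k → ℕP.<⇒≱ (s≤s t<m-1)
        (∣⇒≤ (ℕ∣.∣m+n∣m⇒∣n (≡.subst (m ∣_) (≡.sym (ℕP.+-suc (suc i * m) t)) m∣k) (ℕ∣.n∣m*n (suc i)))))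

    scaledProd-cζ-< : ∀ {j} → j < m → ∀ n → scaledProd cζ j n ≋ scaledProd cq j n
    scaledProd-cζ-< {j} j<m = Cq.scaledProd-cong j λ k _ k≤j → ≋-reflexive (cζ-< (ℕP.≤-<-trans k≤j j<m))

    scaledProd-cζ-high : ∀ {j} → j < m → ∀ a {r} → r < m → scaledProd cζ j (r + suc a * m) ≈ [] mod Φ m
    scaledProd-cζ-high {zero}  _   a {r} _   =
      ≋⇒≈mod (≋-reflexive (cong (scaledProd cζ 0) (ℕP.+-suc r (m-1 + a * m))))
    scaledProd-cζ-high {suc j} j<m a {r} r<m with suc j ≤? r + suc a * m
    ... | no ¬p = ≈mod-trans (Cζ.scaledProd-≰ cζ j _ ¬p) (scaledProd-cζ-high (ℕP.<-trans (ℕP.n<1+n j) j<m) a r<m)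
    ... | yes p = begin
      scaledProd cζ (suc j) N
        ≈⟨ Cζ.scaledProd-≤ cζ j N p ⟩
      scaledProd cζ j N +P (qbinom N (suc j) *P cζ (suc j)) *P scaledProd cζ j (N ∸ suc j)
        ≈⟨ +P-≈mod-congˡ _ (scaledProd-cζ-high j<m′ a r<m) ⟩
      [] +P (qbinom N (suc j) *P cζ (suc j)) *P scaledProd cζ j (N ∸ suc j)
        ≈⟨ term≈0 ⟩
      [] ∎
      where
      open ≈mod-Reasoning
      N = r + suc a * m
      j<m′ = ℕP.<-trans (ℕP.n<1+n j) j<m
      term≈0 : (qbinom N (suc j) *P cζ (suc j)) *P scaledProd cζ j (N ∸ suc j) ≈ [] mod Φ m
      term≈0 with suc j ≤? r
      ... | yes j<r = ≈mod-trans
        (*P-≈mod-congʳ (qbinom N (suc j) *P cζ (suc j))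
          (≈mod-trans (≋⇒≈mod (≋-reflexive (cong (scaledProd cζ j) (ℕP.+-∸-comm (suc a * m) j<r))))
            (scaledProd-cζ-high j<m′ a (ℕP.≤-<-trans (ℕP.m∸n≤m r (suc j)) r<m))))
        (≋⇒≈mod (*P-zeroʳ (qbinom N (suc j) *P cζ (suc j))))
      ... | no r≤j = *P-≈mod-congˡ (scaledProd cζ j (N ∸ suc j))
                       (*P-≈mod-congˡ (cζ (suc j)) (qbinom-digit-low (suc a) (ℕP.≰⇒> r≤j) j<m))

    scaledProd-cζ-gap : ∀ i n {t} → t ≤ m-1 → scaledProd cζ (suc i * m + t) n ≈ scaledProd cζ (suc i * m) n mod Φ m
    scaledProd-cζ-gap i n {zero}  _       =
      ≋⇒≈mod (≋-reflexive (cong (λ j → scaledProd cζ j n) (ℕP.+-identityʳ (suc i * m))))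
    scaledProd-cζ-gap i n {suc t} t<m-1 =
      ≈mod-trans (≋⇒≈mod (≋-reflexive (cong (λ j → scaledProd cζ j n) (ℕP.+-suc (suc i * m) t))))
        (≈mod-trans (Cζ.scaledProd-skip cζ (suc i * m + t) n (≋⇒≈mod (≋-reflexive (cζ-between-multiples i t<m-1))))
          (scaledProd-cζ-gap i n (ℕP.<⇒≤ t<m-1)))

    scaledProd-cζ-next : ∀ i {r} → r < m →
      (∀ a → scaledProd cζ (m-1 + i * m) (r + a * m) ≈ lowProd r *P constP (expProd i a) mod Φ m) →
      ∀ a → scaledProd cζ (suc i * m) (r + a * m) ≈ lowProd r *P constP (expProd (suc i) a) mod Φ m
    scaledProd-cζ-next i {r} r<m IH a with suc i * m ≤? r + a * m | suc i ≤? a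
    ... | no im≰N | _      = begin
      scaledProd cζ (suc J) N                 ≈⟨ Cζ.scaledProd-≰ cζ J N im≰N ⟩
      scaledProd cζ J N                       ≈⟨ IH a ⟩
      lowProd r *P constP (expProd i a)       ≡⟨ cong (λ b → lowProd r *P constP b) (Cℤ.scaledProd-≰ cℤ i a i≰a) ⟨
      lowProd r *P constP (expProd (suc i) a) ∎
      where
      open ≈mod-Reasoning
      N = r + a * m
      J = m-1 + i * m
      i≰a = λ i<a → im≰N (ℕP.≤-trans (ℕP.*-monoˡ-≤ m i<a) (ℕP.m≤n+m (a * m) r))
    ... | yes im≤N | no i≰a = ⊥-elim (ℕP.<⇒≱ (ℕP.<-≤-trans (ℕP.+-monoˡ-< (a * m) r<m) (ℕP.*-monoˡ-≤ m (ℕP.≰⇒> i≰a))) im≤N)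
    ... | yes im≤N | yes i<a with ℕP.m≤n⇒∃[o]m+o≡n i<a
    ...   | d , refl = begin
      scaledProd cζ (suc J) N
        ≈⟨ Cζ.scaledProd-≤ cζ J N im≤N ⟩
      scaledProd cζ J N +P (qbinom N (suc J) *P cζ (suc J)) *P scaledProd cζ J (N ∸ suc J)
        ≈⟨ +P-≈mod-cong (IH (suc i + d))
             (*P-≈mod-cong (*P-≈mod-cong (q-Lucas (suc i + d) (suc i) r<m) (≋⇒≈mod (≋-reflexive (cζ-multiple i))))
               (≈mod-trans (≋⇒≈mod (≋-reflexive (cong (scaledProd cζ J) (+-*m-∸ r (suc i) d)))) (IH d))) ⟩
      lowProd r *P constP (expProd i (suc i + d)) +P (constP b *P constP c) *P (lowProd r *P constP (expProd i d))
        ≈⟨ ≋⇒≈mod (constP-collect (lowProd r) (expProd i (suc i + d)) b c (expProd i d)) ⟩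
      lowProd r *P constP (expProd i (suc i + d) ℤ.+ (b ℤ.* c) ℤ.* expProd i d)
        ≡⟨ cong (λ e → lowProd r *P constP e) expProd-step ⟨
      lowProd r *P constP (expProd (suc i) (suc i + d)) ∎
      where
      open ≈mod-Reasoning
      N = r + (suc i + d) * m
      J = m-1 + i * m
      b = + ((suc i + d) C suc i)
      c = cℤ (suc i)
      expProd-step : expProd (suc i) (suc i + d) ≡ expProd i (suc i + d) ℤ.+ (b ℤ.* c) ℤ.* expProd i d
      expProd-step = ≡.trans (Cℤ.scaledProd-≤ cℤ i (suc i + d) i<a)
                       (cong (λ k → expProd i (suc i + d) ℤ.+ (b ℤ.* c) ℤ.* expProd i k) (ℕP.m+n∸m≡n (suc i) d))

    scaledProd-cζ-factor : ∀ i a {r} → r < m →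
                           scaledProd cζ (m-1 + i * m) (r + a * m) ≈ lowProd r *P constP (expProd i a) mod Φ m
    scaledProd-cζ-factor zero    zero    {r} _   = ≋⇒≈mod $ begin
      scaledProd cζ (m-1 + 0) (r + 0)   ≡⟨ cong₂ (scaledProd cζ) (ℕP.+-identityʳ m-1) (ℕP.+-identityʳ r) ⟩
      scaledProd cζ m-1 r               ≈⟨ scaledProd-cζ-< ℕP.≤-refl r ⟩
      lowProd r                         ≈⟨ *P-identityʳ (lowProd r) ⟨
      lowProd r *P oneP                 ∎
      where open ≋-Reasoning
    scaledProd-cζ-factor zero    (suc a) {r} r<m = begin
      scaledProd cζ (m-1 + 0) (r + suc a * m)   ≡⟨ cong (λ j → scaledProd cζ j (r + suc a * m)) (ℕP.+-identityʳ m-1) ⟩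
      scaledProd cζ m-1 (r + suc a * m)         ≈⟨ scaledProd-cζ-high ℕP.≤-refl a r<m ⟩
      []                                        ≈⟨ ≋⇒≈mod (≋-trans (*P-congʳ (lowProd r) [0]≋[]) (*P-zeroʳ (lowProd r))) ⟨
      lowProd r *P constP (+ 0)                 ∎
      where open ≈mod-Reasoning
    scaledProd-cζ-factor (suc i) a {r} r<m = begin
      scaledProd cζ (m-1 + suc i * m) N         ≡⟨ cong (λ j → scaledProd cζ j N) (ℕP.+-comm m-1 (suc i * m)) ⟩
      scaledProd cζ (suc i * m + m-1) N         ≈⟨ scaledProd-cζ-gap i N ℕP.≤-refl ⟩
      scaledProd cζ (suc i * m) N               ≈⟨ scaledProd-cζ-next i r<m (λ b → scaledProd-cζ-factor i b r<m) a ⟩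
      lowProd r *P constP (expProd (suc i) a)   ∎
      where
      open ≈mod-Reasoning
      N = r + a * m

    scaledProd-cζ-diag : ∀ n → scaledProd cζ n n ≈ oneP mod Φ m
    scaledProd-cζ-diag n = begin
      scaledProd cζ n n                          ≈⟨ Cζ.scaledProd-stable cζ (J ∸ n) n ⟨
      scaledProd cζ (J ∸ n + n) n                ≡⟨ cong₂ (scaledProd cζ) (ℕP.m∸n+n≡m n≤J) (m≡m%n+[m/n]*n n m) ⟩
      scaledProd cζ J (r + a * m)                ≈⟨ scaledProd-cζ-factor a a r<m ⟩
      lowProd r *P constP (expProd a a)
        ≈⟨ *P-≈mod-cong (≋⇒≈mod (Cq.scaledProd-above qbinom-diag (ℕP.≤-pred r<m)))
                        (≋⇒≈mod (≋-reflexive (cong constP (Cℤ.scaledProd-diag (λ n → cong +_ (nCn≡1 n)) a)))) ⟩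
      oneP *P oneP                               ≈⟨ ≈mod-refl ⟩
      oneP                                       ∎
      where
      open ≈mod-Reasoning
      r = n ℕ.% m
      a = n ℕ./ m
      J = m-1 + a * m
      r<m : r < m
      r<m = m%n<n n m
      n≤J : n ≤ J
      n≤J = ≡.subst (_≤ J) (≡.sym (m≡m%n+[m/n]*n n m)) (ℕP.+-monoˡ-≤ (a * m) (ℕP.≤-pred r<m))

    cζ≈cq : ∀ k → 1 ≤ k → cζ k ≈ cq k mod Φ m
    cζ≈cq = Cζ.scaledCoeff-unique qbinom-diag-≈mod cζ scaledProd-cζ-diag

    cq-multiple : ∀ k → 1 ≤ k → cq (m * k) ≈ constP (cℤ k) mod Φ m
    cq-multiple (suc i) _ = ≈mod-trans (≈mod-sym (cζ≈cq (m * suc i) (s≤s z≤n)))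
                              (≋⇒≈mod (≋-reflexive (≡.trans (cong cζ (ℕP.*-comm m (suc i))) (cζ-multiple i))))

    cq-nonmultiple : ∀ {n} → m ≤ n → ¬ m ∣ n → cq n ≈ [] mod Φ m
    cq-nonmultiple {n} m≤n m∤n = ≈mod-trans (≈mod-sym (cζ≈cq n (ℕP.≤-trans (s≤s z≤n) m≤n)))
                                   (≋⇒≈mod (≋-reflexive (cζ-other (ℕP.≤⇒≯ m≤n) m∤n)))

≈mod⇒EvalAtZeta : ∀ Φ m {P c} → P ≈ constP c mod Φ m → EvalAtZeta Φ m P c
≈mod⇒EvalAtZeta Φ m (mod-by w e) = w , coeff-≡ e

theorem4p3 : (Φ : ℕ → Poly) → IsCyclotomic Φ →
    (m n : ℕ) → 1 ≤ m → m ≤ n →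
    ((k : ℕ) → n ≡ m * k →
      Σ Poly λ P → Σ ℤ λ c →
        IsCq n P × (c / 1 ≡ cExp k) × EvalAtZeta Φ m P c)
    × (¬ (m ∣ n) →
      Σ Poly λ P → IsCq n P × EvalAtZeta Φ m P (+ 0))
theorem4p3 Φ cyc m@(suc m-1) n 1≤m m≤n = multiple , nonmultiple
  where
  open Cyclotomic.Order Φ cyc m-1 using (cq-multiple; cq-nonmultiple; ≈mod-trans; ≋⇒≈mod)
  1≤n = ℕP.≤-trans 1≤m m≤n
  multiple : (k : ℕ) → n ≡ m * k → Σ Poly λ P → Σ ℤ λ c → IsCq n P × (c / 1 ≡ cExp k) × EvalAtZeta Φ m P c
  multiple k n≡mk = cq n , cℤ k , cq-isCq n 1≤n , cℤ≡cExp k 1≤k ,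
                    ≈mod⇒EvalAtZeta Φ m (≡.subst (λ t → cq t ≈ constP (cℤ k) mod Φ m) (≡.sym n≡mk) (cq-multiple k 1≤k))
    where
    1≤k : 1 ≤ k
    1≤k = ℕP.n≢0⇒n>0 λ { refl → ℕP.<⇒≢ 1≤n (≡.sym (≡.trans n≡mk (ℕP.*-zeroʳ m))) }
  nonmultiple : ¬ m ∣ n → Σ Poly λ P → IsCq n P × EvalAtZeta Φ m P (+ 0)
  nonmultiple m∤n = cq n , cq-isCq n 1≤n ,
                    ≈mod⇒EvalAtZeta Φ m (≈mod-trans (cq-nonmultiple m≤n m∤n) (≋⇒≈mod (≋-sym [0]≋[])))
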